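{- Let $k,n,m$ be positive integers, let $A\subseteq[k]^n$ have uniform density $\delta$, let $\eta>0$, let $m\leq n^{1/4}$ and suppose $n\geq(16k/\eta)^{12}$. Let $J$ be a uniformly random subset of $[n]$ of size $m$ and $y$ a uniformly random element of $[k]^{\overline{J}}$. Then the expected equal-slices density of $A$ inside the combinatorial subspace $S_{J,y}$ is at least $\delta-\eta$. In particular there exist $J$ and $y$ such that the equal-slices density of $A$ inside $S_{J,y}$ is at least $\delta-\eta$.
   Context: For $J\subseteq[n]$ with complement $\overline J$ and $y\in[k]^{\overline J}$, $S_{J,y}=\{(x,y):x\in[k]^J\}\subseteq[k]^n$ (points written as pairs of their restrictions to $J$ and $\overline J$). The equal-slices density of $A$ inside $S_{J,y}$ is the equal-slices measure of $\{x\in[k]^J:(x,y)\in A\}$ in $[k]^J\cong[k]^m$, where the equal-slices measure on $[k]^m$ is: choose uniformly a $k$-tuple $(a_1,\dots,a_k)$ of non-negative integers summing to $m$, then a uniform sequence with exactly $a_j$ coordinates equal to $j$ for each $j$. Uniform density means $|A|/k^n$.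
   Formalization: The parameter η ranges over the positive rationals. -}

module Defs where

open import Data.Nat as ℕ using (ℕ; zero; suc)
open import Data.Bool using (Bool; true; false; _∧_)
open import Data.Fin as Fin using (Fin)
open import Data.Vec as Vec using (Vec; []; _∷_; tabulate; countᵇ)
open import Data.List as List using (List; []; _∷_; map; concatMap; filterᵇ; length; foldr; allFin; upTo)
open import Data.Integer using (+_)
open import Data.Rational using (ℚ; 0ℚ; 1ℚ; _+_; _*_; _/_)
open import Relation.Nullary.Decidable using (isYes)

allVecs : ∀ {a} {A : Set a} → List A → (n : ℕ) → List (Vec A n)
allVecs xs zero = [] ∷ []
allVecs xs (suc n) = concatMap (λ v → map (_∷ v) xs) (allVecs xs n)

cube : (k n : ℕ) → List (Vec (Fin k) n)
cube k n = allVecs (allFin k) n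

countL : ∀ {a} {A : Set a} → (A → Bool) → List A → ℕ
countL p xs = length (filterᵇ p xs)

-- a / b as a rational (b = 0 gives 0; never used with b = 0 here)
frac : ℕ → ℕ → ℚ
frac a zero = 0ℚ
frac a (suc b) = (+ a) / suc b

sumℚ : List ℚ → ℚ
sumℚ = foldr _+_ 0ℚ

powℚ : ℚ → ℕ → ℚ
powℚ q zero = 1ℚ
powℚ q (suc e) = q * powℚ q e

-- subsets J ⊆ [n] as characteristic vectors
Subset : ℕ → Set
Subset n = Vec Bool n

trues : ∀ {n} → Subset n → ℕ
trues [] = zero
trues (true ∷ J) = suc (trues J)
trues (false ∷ J) = trues J

falses : ∀ {n} → Subset n → ℕ
falses [] = zero
falses (true ∷ J) = falses J
falses (false ∷ J) = suc (falses J)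

-- the point (x , y) of [k]^n, where x ∈ [k]^J and y ∈ [k]^(complement of J);
-- [k]^J is identified with [k]^|J| listing the coordinates of J in increasing order
-- (likewise for the complement)
merge : ∀ {a} {A : Set a} {n} (J : Subset n) → Vec A (trues J) → Vec A (falses J) → Vec A n
merge [] [] [] = []
merge (true ∷ J) (a ∷ x) y = a ∷ merge J x y
merge (false ∷ J) x (b ∷ y) = b ∷ merge J x y

typeOf : ∀ {k m} → Vec (Fin k) m → Vec ℕ k
typeOf x = tabulate (λ j → countᵇ (λ i → isYes (i Fin.≟ j)) x)

vecEqᵇ : ∀ {k} → Vec ℕ k → Vec ℕ k → Bool
vecEqᵇ [] [] = true
vecEqᵇ (a ∷ as) (b ∷ bs) = (a ℕ.≡ᵇ b) ∧ vecEqᵇ as bs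

compositions : (k m : ℕ) → List (Vec ℕ k)
compositions k m = filterᵇ (λ a → Vec.sum a ℕ.≡ᵇ m) (allVecs (upTo (suc m)) k)

-- equal-slices measure of B ⊆ [k]^m: average over uniform composition a of the
-- proportion of the slice {x : typeOf x = a} lying in B
equalSlices : (k m : ℕ) → (Vec (Fin k) m → Bool) → ℚ
equalSlices k m B =
  frac 1 (length (compositions k m)) *
  sumℚ (map (λ a → frac (countL (λ x → B x ∧ vecEqᵇ a (typeOf x)) (cube k m))
                        (countL (λ x → vecEqᵇ a (typeOf x)) (cube k m)))
            (compositions k m))

uniformDensity : (k n : ℕ) → (Vec (Fin k) n → Bool) → ℚ
uniformDensity k n A = frac (countL A (cube k n)) (k ℕ.^ n)

sliceDensity : ∀ {k n} (A : Vec (Fin k) n → Bool) (J : Subset n) → Vec (Fin k) (falses J) → ℚ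
sliceDensity {k} A J y = equalSlices k (trues J) (λ x → A (merge J x y))

subsetsOfSize : (n m : ℕ) → List (Subset n)
subsetsOfSize n m = filterᵇ (λ J → trues J ℕ.≡ᵇ m) (allVecs (true ∷ false ∷ []) n)

expectedSliceDensity : (k n m : ℕ) → (Vec (Fin k) n → Bool) → ℚ
expectedSliceDensity k n m A =
  frac 1 (length (subsetsOfSize n m)) *
  sumℚ (map (λ J → frac 1 (k ℕ.^ falses J) *
                   sumℚ (map (λ y → sliceDensity A J y) (cube k (falses J))))
            (subsetsOfSize n m))

module Submission where

-- Fix a composition a of m and let cⱼ(z) be the number of occurrences of j in z ∈ [k]ⁿ. Averaged
-- over J and y, the density of A in the slice of type a of S_{J,y} is a ratio of two double counts,
-- and exchanging the order of summation writes both as sums over z weighted by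
-- w(z) = #{J : |J| = m, type(z|J) = a} = ∏ⱼ C(cⱼ(z), aⱼ). Take N ≥ 1/η and D ≈ n/(32 m N). If every
-- k·cⱼ(z) is within D of n, then w(z) is a fixed constant up to a factor 1 ± O(1/N) (bounds on
-- falling factorials and Bernoulli's inequality), and Chebyshev's inequality for the cⱼ shows that
-- the remaining points z carry only a fraction O(1/N) of the points and of the total weight; the
-- hypothesis n ≥ (16k/η)¹² is what makes these error terms small. Hence the ratio is at least
-- |A|/kⁿ - 1/N ≥ δ - η for every a. The expectation is the average of these ratios over a, and an
-- average that is at least δ - η has a term that is at least δ - η.

module FiniteSums where

  open import Level using (Level)
  open import Data.Nat using (ℕ; zero; suc; _+_; _*_; _^_; _≤_; z≤n; s≤s)
  open import Data.Nat.Properties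
  open import Data.Bool using (Bool; true; false; _∧_; _∨_)
  open import Data.Fin as Fin using (Fin)
  open import Data.List using (List; []; _∷_; map; concatMap; filterᵇ; length; tabulate; allFin; _++_)
  open import Data.List.Relation.Unary.All using (All; []; _∷_)
  open import Relation.Binary.PropositionalEquality
  open import Data.Nat.Solver using (module +-*-Solver)
  open +-*-Solver using (solve; _:+_; _:*_; _:=_)
  open import Defs using (countL)

  𝟙 : Bool → ℕ
  𝟙 true = 1
  𝟙 false = 0

  𝟙≤1 : ∀ b → 𝟙 b ≤ 1
  𝟙≤1 true = ≤-refl
  𝟙≤1 false = z≤n

  𝟙-∧ : ∀ a b → 𝟙 (a ∧ b) ≡ 𝟙 a * 𝟙 b
  𝟙-∧ true b = sym (+-identityʳ (𝟙 b))
  𝟙-∧ false b = refl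

  𝟙-∨ : ∀ a b → 𝟙 (a ∨ b) ≤ 𝟙 a + 𝟙 b
  𝟙-∨ true b = s≤s z≤n
  𝟙-∨ false b = ≤-refl

  private
    variable
      a b p : Level
      A : Set a
      B : Set b

  ∑ : List A → (A → ℕ) → ℕ
  ∑ [] f = 0
  ∑ (x ∷ xs) f = f x + ∑ xs f

  ∑-cong : ∀ xs {f g : A → ℕ} → (∀ x → f x ≡ g x) → ∑ xs f ≡ ∑ xs g
  ∑-cong [] e = refl
  ∑-cong (x ∷ xs) e = cong₂ _+_ (e x) (∑-cong xs e)

  ∑-congᴬ : ∀ {P : A → Set p} xs {f g : A → ℕ} → All P xs → (∀ x → P x → f x ≡ g x) → ∑ xs f ≡ ∑ xs g
  ∑-congᴬ [] _ e = refl
  ∑-congᴬ (x ∷ xs) (px ∷ pxs) e = cong₂ _+_ (e x px) (∑-congᴬ xs pxs e)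

  ∑-mono : ∀ xs {f g : A → ℕ} → (∀ x → f x ≤ g x) → ∑ xs f ≤ ∑ xs g
  ∑-mono [] e = z≤n
  ∑-mono (x ∷ xs) e = +-mono-≤ (e x) (∑-mono xs e)

  ∑-monoᴬ : ∀ {P : A → Set p} xs {f g : A → ℕ} → All P xs → (∀ x → P x → f x ≤ g x) → ∑ xs f ≤ ∑ xs g
  ∑-monoᴬ [] _ e = z≤n
  ∑-monoᴬ (x ∷ xs) (px ∷ pxs) e = +-mono-≤ (e x px) (∑-monoᴬ xs pxs e)

  ∑-+ : ∀ xs (f g : A → ℕ) → ∑ xs (λ x → f x + g x) ≡ ∑ xs f + ∑ xs g
  ∑-+ [] f g = refl
  ∑-+ (x ∷ xs) f g rewrite ∑-+ xs f g = +-+-comm (f x) (g x) (∑ xs f) (∑ xs g)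
    where
    +-+-comm : ∀ a b c d → (a + b) + (c + d) ≡ (a + c) + (b + d)
    +-+-comm = solve 4 (λ a b c d → (a :+ b) :+ (c :+ d) := (a :+ c) :+ (b :+ d)) refl

  ∑-*ˡ : ∀ xs c (f : A → ℕ) → ∑ xs (λ x → c * f x) ≡ c * ∑ xs f
  ∑-*ˡ [] c f = sym (*-zeroʳ c)
  ∑-*ˡ (x ∷ xs) c f rewrite ∑-*ˡ xs c f = sym (*-distribˡ-+ c (f x) (∑ xs f))

  ∑-*ʳ : ∀ xs c (f : A → ℕ) → ∑ xs (λ x → f x * c) ≡ ∑ xs f * c
  ∑-*ʳ xs c f = trans (∑-cong xs (λ x → *-comm (f x) c)) (trans (∑-*ˡ xs c f) (*-comm c (∑ xs f)))

  ∑-const : ∀ (xs : List A) c → ∑ xs (λ _ → c) ≡ length xs * c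
  ∑-const [] c = refl
  ∑-const (x ∷ xs) c = cong (c +_) (∑-const xs c)

  ∑-++ : ∀ xs ys (f : A → ℕ) → ∑ (xs ++ ys) f ≡ ∑ xs f + ∑ ys f
  ∑-++ [] ys f = refl
  ∑-++ (x ∷ xs) ys f rewrite ∑-++ xs ys f = sym (+-assoc (f x) (∑ xs f) (∑ ys f))

  ∑-map : ∀ (g : A → B) xs (f : B → ℕ) → ∑ (map g xs) f ≡ ∑ xs (λ x → f (g x))
  ∑-map g [] f = refl
  ∑-map g (x ∷ xs) f = cong (f (g x) +_) (∑-map g xs f)

  ∑-concatMap : ∀ (g : A → List B) xs (f : B → ℕ) → ∑ (concatMap g xs) f ≡ ∑ xs (λ x → ∑ (g x) f)
  ∑-concatMap g [] f = refl
  ∑-concatMap g (x ∷ xs) f = trans (∑-++ (g x) (concatMap g xs) f) (cong (∑ (g x) f +_) (∑-concatMap g xs f))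

  ∑-filter : ∀ (p : A → Bool) xs (f : A → ℕ) → ∑ (filterᵇ p xs) f ≡ ∑ xs (λ x → 𝟙 (p x) * f x)
  ∑-filter p [] f = refl
  ∑-filter p (x ∷ xs) f with p x
  ... | true = cong₂ _+_ (sym (+-identityʳ (f x))) (∑-filter p xs f)
  ... | false = ∑-filter p xs f

  countL≡∑𝟙 : ∀ (p : A → Bool) xs → countL p xs ≡ ∑ xs (λ x → 𝟙 (p x))
  countL≡∑𝟙 p [] = refl
  countL≡∑𝟙 p (x ∷ xs) with p x
  ... | true = cong suc (countL≡∑𝟙 p xs)
  ... | false = countL≡∑𝟙 p xs

  length≡∑1 : ∀ (xs : List A) → length xs ≡ ∑ xs (λ _ → 1)
  length≡∑1 [] = refl
  length≡∑1 (x ∷ xs) = cong suc (length≡∑1 xs)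

  ∑-comm : ∀ (xs : List A) (ys : List B) (f : A → B → ℕ) →
    ∑ xs (λ x → ∑ ys (f x)) ≡ ∑ ys (λ y → ∑ xs (λ x → f x y))
  ∑-comm [] ys f = sym (trans (∑-const ys 0) (*-zeroʳ (length ys)))
  ∑-comm (x ∷ xs) ys f rewrite ∑-comm xs ys f = sym (∑-+ ys (f x) (λ y → ∑ xs (λ x → f x y)))

  ∑ᶠ : ∀ {k} → (Fin k → ℕ) → ℕ
  ∑ᶠ {zero} f = 0
  ∑ᶠ {suc k} f = f Fin.zero + ∑ᶠ (λ i → f (Fin.suc i))

  ∑-tabulate : ∀ {k} (g : Fin k → A) (f : A → ℕ) → ∑ (tabulate g) f ≡ ∑ᶠ (λ i → f (g i))
  ∑-tabulate {k = zero} g f = refl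
  ∑-tabulate {k = suc k} g f = cong (f (g Fin.zero) +_) (∑-tabulate (λ i → g (Fin.suc i)) f)

  ∑-allFin : ∀ k (f : Fin k → ℕ) → ∑ (allFin k) f ≡ ∑ᶠ f
  ∑-allFin k f = ∑-tabulate (λ i → i) f

  ∑ᶠ-cong : ∀ {k} {f g : Fin k → ℕ} → (∀ i → f i ≡ g i) → ∑ᶠ f ≡ ∑ᶠ g
  ∑ᶠ-cong {zero} e = refl
  ∑ᶠ-cong {suc k} e = cong₂ _+_ (e Fin.zero) (∑ᶠ-cong (λ i → e (Fin.suc i)))

  ∑ᶠ-mono : ∀ {k} {f g : Fin k → ℕ} → (∀ i → f i ≤ g i) → ∑ᶠ f ≤ ∑ᶠ g
  ∑ᶠ-mono {zero} e = z≤n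
  ∑ᶠ-mono {suc k} e = +-mono-≤ (e Fin.zero) (∑ᶠ-mono (λ i → e (Fin.suc i)))

  ∑ᶠ-+ : ∀ {k} (f g : Fin k → ℕ) → ∑ᶠ (λ i → f i + g i) ≡ ∑ᶠ f + ∑ᶠ g
  ∑ᶠ-+ {k} f g = trans (sym (∑-allFin k _)) (trans (∑-+ (allFin k) f g) (cong₂ _+_ (∑-allFin k f) (∑-allFin k g)))

  ∑ᶠ-*ˡ : ∀ {k} c (f : Fin k → ℕ) → ∑ᶠ (λ i → c * f i) ≡ c * ∑ᶠ f
  ∑ᶠ-*ˡ {k} c f = trans (sym (∑-allFin k _)) (trans (∑-*ˡ (allFin k) c f) (cong (c *_) (∑-allFin k f)))

  ∑ᶠ-const : ∀ k c → ∑ᶠ {k} (λ _ → c) ≡ k * c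
  ∑ᶠ-const zero c = refl
  ∑ᶠ-const (suc k) c = cong (c +_) (∑ᶠ-const k c)

  ≤∑ᶠ : ∀ {k} (f : Fin k → ℕ) j → f j ≤ ∑ᶠ f
  ≤∑ᶠ f Fin.zero = m≤m+n _ _
  ≤∑ᶠ {suc k} f (Fin.suc j) = ≤-trans (≤∑ᶠ (λ i → f (Fin.suc i)) j) (m≤n+m _ (f Fin.zero))

  ∏ᶠ : ∀ {k} → (Fin k → ℕ) → ℕ
  ∏ᶠ {zero} f = 1
  ∏ᶠ {suc k} f = f Fin.zero * ∏ᶠ (λ i → f (Fin.suc i))

  ∏ᶠ-cong : ∀ {k} {f g : Fin k → ℕ} → (∀ i → f i ≡ g i) → ∏ᶠ f ≡ ∏ᶠ g
  ∏ᶠ-cong {zero} e = refl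
  ∏ᶠ-cong {suc k} e = cong₂ _*_ (e Fin.zero) (∏ᶠ-cong (λ i → e (Fin.suc i)))

  ∏ᶠ-mono : ∀ {k} {f g : Fin k → ℕ} → (∀ i → f i ≤ g i) → ∏ᶠ f ≤ ∏ᶠ g
  ∏ᶠ-mono {zero} e = ≤-refl
  ∏ᶠ-mono {suc k} e = *-mono-≤ (e Fin.zero) (∏ᶠ-mono (λ i → e (Fin.suc i)))

  ∏ᶠ-* : ∀ {k} (f g : Fin k → ℕ) → ∏ᶠ (λ i → f i * g i) ≡ ∏ᶠ f * ∏ᶠ g
  ∏ᶠ-* {zero} f g = refl
  ∏ᶠ-* {suc k} f g rewrite ∏ᶠ-* (λ i → f (Fin.suc i)) (λ i → g (Fin.suc i)) =
    *-*-comm (f Fin.zero) (g Fin.zero) (∏ᶠ (λ i → f (Fin.suc i))) (∏ᶠ (λ i → g (Fin.suc i)))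
    where
    *-*-comm : ∀ a b c d → (a * b) * (c * d) ≡ (a * c) * (b * d)
    *-*-comm = solve 4 (λ a b c d → (a :* b) :* (c :* d) := (a :* c) :* (b :* d)) refl

  ∏ᶠ-^ : ∀ {k} x (e : Fin k → ℕ) → ∏ᶠ (λ i → x ^ e i) ≡ x ^ ∑ᶠ e
  ∏ᶠ-^ {zero} x e = refl
  ∏ᶠ-^ {suc k} x e rewrite ∏ᶠ-^ x (λ i → e (Fin.suc i)) = sym (^-distribˡ-+-* x (e Fin.zero) (∑ᶠ (λ i → e (Fin.suc i))))

  anyᶠ : ∀ {k} → (Fin k → Bool) → Bool
  anyᶠ {zero} f = false
  anyᶠ {suc k} f = f Fin.zero ∨ anyᶠ (λ i → f (Fin.suc i))

  𝟙-anyᶠ : ∀ {k} (f : Fin k → Bool) → 𝟙 (anyᶠ f) ≤ ∑ᶠ (λ j → 𝟙 (f j))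
  𝟙-anyᶠ {zero} f = z≤n
  𝟙-anyᶠ {suc k} f = ≤-trans (𝟙-∨ (f Fin.zero) _) (+-monoʳ-≤ (𝟙 (f Fin.zero)) (𝟙-anyᶠ (λ i → f (Fin.suc i))))

  anyᶠ-false : ∀ {k} (f : Fin k → Bool) → anyᶠ f ≡ false → ∀ j → f j ≡ false
  anyᶠ-false {suc k} f e Fin.zero with f Fin.zero
  ... | false = refl
  anyᶠ-false {suc k} f e (Fin.suc j) with f Fin.zero
  ... | false = anyᶠ-false (λ i → f (Fin.suc i)) e j

  anyᶠ-mono : ∀ {k} (f g : Fin k → Bool) → (∀ j → f j ≡ true → g j ≡ true) → 𝟙 (anyᶠ f) ≤ 𝟙 (anyᶠ g)
  anyᶠ-mono {zero} f g h = z≤n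
  anyᶠ-mono {suc k} f g h with f Fin.zero in e
  ... | true rewrite h Fin.zero e = ≤-refl
  ... | false with g Fin.zero
  ... | true = 𝟙≤1 _
  ... | false = anyᶠ-mono (λ i → f (Fin.suc i)) (λ i → g (Fin.suc i)) (λ j → h (Fin.suc j))


module Words where

  open import Data.Nat as ℕ using (ℕ; zero; suc; _+_; _*_; _^_; _≤_; z≤n; s≤s)
  open import Data.Nat.Properties
  open import Data.Bool using (Bool; true; false; T; not; _∧_; if_then_else_)
  open import Data.Fin as Fin using (Fin)
  open import Data.Vec as Vec using (Vec; []; _∷_)
  open import Data.Vec.Properties using (lookup∘tabulate; tabulate∘lookup; tabulate-cong)
  open import Data.List using (allFin; length; map)
  open import Data.List.Properties using (length-tabulate)
  open import Relation.Nullary using (yes; no; contradiction)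
  open import Relation.Nullary.Decidable using (isYes; toWitness; toWitnessFalse)
  open import Function using (_∘_)
  open import Relation.Binary.PropositionalEquality
  open import Data.Nat.Solver using (module +-*-Solver)
  open +-*-Solver using (solve; _:*_; _:=_)
  open import Defs
  open FiniteSums

  _≟ᵇ_ : ∀ {k} → Fin k → Fin k → Bool
  i ≟ᵇ j = isYes (i Fin.≟ j)

  ≟ᵇ-suc : ∀ {k} (i j : Fin k) → Fin.suc i ≟ᵇ Fin.suc j ≡ i ≟ᵇ j
  ≟ᵇ-suc i j with i Fin.≟ j
  ... | yes _ = refl
  ... | no _ = refl

  ≟ᵇ-refl : ∀ {k} (i : Fin k) → i ≟ᵇ i ≡ true
  ≟ᵇ-refl i with i Fin.≟ i
  ... | yes _ = refl
  ... | no i≢i = contradiction refl i≢i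

  ≟ᵇ⇒≡ : ∀ {k} {i j : Fin k} → i ≟ᵇ j ≡ true → i ≡ j
  ≟ᵇ⇒≡ e = toWitness (subst T (sym e) _)

  ≟ᵇ⇒≢ : ∀ {k} {i j : Fin k} → i ≟ᵇ j ≡ false → i ≢ j
  ≟ᵇ⇒≢ e = toWitnessFalse (subst (T ∘ not) (sym e) _)

  ≟ᵇ-sym : ∀ {k} (i j : Fin k) → i ≟ᵇ j ≡ j ≟ᵇ i
  ≟ᵇ-sym i j with i Fin.≟ j | j Fin.≟ i
  ... | yes _ | yes _ = refl
  ... | no _ | no _ = refl
  ... | yes i≡j | no j≢i = contradiction (sym i≡j) j≢i
  ... | no i≢j | yes j≡i = contradiction (sym j≡i) i≢j

  ∑ᶠ-𝟙≟ᵇ : ∀ {k} (j : Fin k) → ∑ᶠ (λ i → 𝟙 (i ≟ᵇ j)) ≡ 1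
  ∑ᶠ-𝟙≟ᵇ {suc k} Fin.zero = cong suc (trans (∑ᶠ-const k 0) (*-zeroʳ k))
  ∑ᶠ-𝟙≟ᵇ {suc k} (Fin.suc j) = trans (∑ᶠ-cong (λ i → cong 𝟙 (≟ᵇ-suc i j))) (∑ᶠ-𝟙≟ᵇ j)

  ∑ᶠ-𝟙≟ᵇ′ : ∀ {k} (i : Fin k) → ∑ᶠ (λ j → 𝟙 (i ≟ᵇ j)) ≡ 1
  ∑ᶠ-𝟙≟ᵇ′ i = trans (∑ᶠ-cong (λ j → cong 𝟙 (≟ᵇ-sym i j))) (∑ᶠ-𝟙≟ᵇ i)

  ∏ᶠ-split : ∀ {k} (f : Fin k → ℕ) j → ∏ᶠ f ≡ f j * ∏ᶠ (λ i → if i ≟ᵇ j then 1 else f i)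
  ∏ᶠ-split {suc k} f Fin.zero = cong (f Fin.zero *_) (sym (*-identityˡ _))
  ∏ᶠ-split {suc k} f (Fin.suc j) rewrite ∏ᶠ-split (λ i → f (Fin.suc i)) j =
    trans (*-left-comm (f Fin.zero) (f (Fin.suc j)) _)
          (cong (λ t → f (Fin.suc j) * (f Fin.zero * t)) (∏ᶠ-cong (λ i → cong (λ b → if b then 1 else f (Fin.suc i)) (sym (≟ᵇ-suc i j)))))
    where
    *-left-comm : ∀ a b c → a * (b * c) ≡ b * (a * c)
    *-left-comm = solve 3 (λ a b c → a :* (b :* c) := b :* (a :* c)) refl

  occ : ∀ {k m} → Fin k → Vec (Fin k) m → ℕ
  occ j x = Vec.countᵇ (_≟ᵇ j) x

  occ-∷ : ∀ {k m} (j i : Fin k) (x : Vec (Fin k) m) → occ j (i ∷ x) ≡ 𝟙 (i ≟ᵇ j) + occ j x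
  occ-∷ j i x with i ≟ᵇ j
  ... | true = refl
  ... | false = refl

  occ-∷-≡ : ∀ {k m} (i : Fin k) (x : Vec (Fin k) m) → occ i (i ∷ x) ≡ suc (occ i x)
  occ-∷-≡ i x = trans (occ-∷ i i x) (cong (λ b → 𝟙 b + occ i x) (≟ᵇ-refl i))

  occ-∷-≢ : ∀ {k m} (i j : Fin k) (x : Vec (Fin k) m) → j ≟ᵇ i ≡ false → occ j (i ∷ x) ≡ occ j x
  occ-∷-≢ i j x e = trans (occ-∷ j i x) (cong (λ b → 𝟙 b + occ j x) (trans (≟ᵇ-sym i j) e))

  occ≤length : ∀ {k m} (j : Fin k) (x : Vec (Fin k) m) → occ j x ≤ m
  occ≤length j [] = z≤n
  occ≤length j (i ∷ x) rewrite occ-∷ j i x with i ≟ᵇ j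
  ... | true = s≤s (occ≤length j x)
  ... | false = m≤n⇒m≤1+n (occ≤length j x)

  ∑ᶠ-occ : ∀ {k m} (x : Vec (Fin k) m) → ∑ᶠ (λ j → occ j x) ≡ m
  ∑ᶠ-occ {k} [] = trans (∑ᶠ-const k 0) (*-zeroʳ k)
  ∑ᶠ-occ {k} (i ∷ x) = trans (∑ᶠ-cong (λ j → occ-∷ j i x)) (trans (∑ᶠ-+ {k} _ _) (cong₂ _+_ (∑ᶠ-𝟙≟ᵇ′ i) (∑ᶠ-occ x)))

  lookup-typeOf : ∀ {k m} (x : Vec (Fin k) m) j → Vec.lookup (typeOf x) j ≡ occ j x
  lookup-typeOf x j = lookup∘tabulate _ j

  sum≡∑ᶠ : ∀ {k} (a : Vec ℕ k) → Vec.sum a ≡ ∑ᶠ (Vec.lookup a)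
  sum≡∑ᶠ [] = refl
  sum≡∑ᶠ (x ∷ a) = cong (x +_) (sum≡∑ᶠ a)

  sum-typeOf : ∀ {k m} (x : Vec (Fin k) m) → Vec.sum (typeOf x) ≡ m
  sum-typeOf x = trans (sum≡∑ᶠ (typeOf x)) (trans (∑ᶠ-cong (lookup-typeOf x)) (∑ᶠ-occ x))

  lookup-ext : ∀ {A : Set} {k} (a b : Vec A k) → (∀ j → Vec.lookup a j ≡ Vec.lookup b j) → a ≡ b
  lookup-ext a b e = trans (sym (tabulate∘lookup a)) (trans (tabulate-cong e) (tabulate∘lookup b))

  vecEqᵇ⇒≡ : ∀ {k} (a b : Vec ℕ k) → vecEqᵇ a b ≡ true → a ≡ b
  vecEqᵇ⇒≡ [] [] e = refl
  vecEqᵇ⇒≡ (x ∷ a) (y ∷ b) e with x ℕ.≡ᵇ y in eq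
  ... | true = cong₂ _∷_ (≡ᵇ⇒≡ x y (subst T (sym eq) _)) (vecEqᵇ⇒≡ a b e)

  ≡ᵇ-refl : ∀ n → (n ℕ.≡ᵇ n) ≡ true
  ≡ᵇ-refl zero = refl
  ≡ᵇ-refl (suc n) = ≡ᵇ-refl n

  vecEqᵇ-refl : ∀ {k} (a : Vec ℕ k) → vecEqᵇ a a ≡ true
  vecEqᵇ-refl [] = refl
  vecEqᵇ-refl (x ∷ a) = cong₂ _∧_ (≡ᵇ-refl x) (vecEqᵇ-refl a)

  vecEqᵇ-false : ∀ {k} (a b : Vec ℕ k) j → Vec.lookup a j ≢ Vec.lookup b j → vecEqᵇ a b ≡ false
  vecEqᵇ-false a b j ne with vecEqᵇ a b in eq
  ... | true = contradiction (cong (λ v → Vec.lookup v j) (vecEqᵇ⇒≡ a b eq)) ne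
  ... | false = refl

  ∑-cube-suc : ∀ {k} n (f : Vec (Fin k) (suc n) → ℕ) → ∑ (cube k (suc n)) f ≡ ∑ (cube k n) (λ v → ∑ (allFin k) (λ i → f (i ∷ v)))
  ∑-cube-suc {k} n f = trans (∑-concatMap (λ v → map (_∷ v) (allFin k)) (cube k n) f)
    (∑-cong (cube k n) (λ v → ∑-map (_∷ v) (allFin k) f))

  length-cube : ∀ k n → length (cube k n) ≡ k ^ n
  length-cube k zero = refl
  length-cube k (suc n) = begin
    length (cube k (suc n))                     ≡⟨ length≡∑1 (cube k (suc n)) ⟩
    ∑ (cube k (suc n)) (λ _ → 1)                ≡⟨ ∑-cube-suc n (λ _ → 1) ⟩
    ∑ (cube k n) (λ _ → ∑ (allFin k) (λ _ → 1)) ≡⟨ ∑-cong (cube k n) (λ _ → sym (length≡∑1 (allFin k))) ⟩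
    ∑ (cube k n) (λ _ → length (allFin k))      ≡⟨ ∑-const (cube k n) _ ⟩
    length (cube k n) * length (allFin k)       ≡⟨ cong₂ _*_ (length-cube k n) (length-tabulate (λ i → i)) ⟩
    k ^ n * k                                   ≡⟨ *-comm (k ^ n) k ⟩
    k ^ suc n                                   ∎
    where open ≡-Reasoning


module Restriction where

  open import Data.Nat using (ℕ; suc; _+_)
  open import Data.Nat.Properties using (+-identityʳ; +-assoc; +-comm; +-suc)
  open import Data.Bool using (true; false)
  open import Data.Fin using (Fin)
  open import Data.Vec using (Vec; []; _∷_)
  open import Data.List using (allFin)
  open import Relation.Binary.PropositionalEquality
  open import Defs
  open FiniteSums
  open Words

  restrict : ∀ {A : Set} {n} (J : Subset n) → Vec A n → Vec A (trues J)
  restrict [] [] = []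
  restrict (true ∷ J) (a ∷ z) = a ∷ restrict J z
  restrict (false ∷ J) (a ∷ z) = restrict J z

  trues+falses : ∀ {n} (J : Subset n) → trues J + falses J ≡ n
  trues+falses [] = refl
  trues+falses (true ∷ J) = cong suc (trues+falses J)
  trues+falses (false ∷ J) = trans (+-suc (trues J) (falses J)) (cong suc (trues+falses J))

  -- (x , y) ↦ merge J x y is a bijection [k]^J × [k]^(complement of J) → [k]^n with inverse z ↦ (restrict J z , _).
  ∑-merge : ∀ {k n} (J : Subset n) (h : Vec (Fin k) n → Vec (Fin k) (trues J) → ℕ) →
    ∑ (cube k (falses J)) (λ y → ∑ (cube k (trues J)) (λ x → h (merge J x y) x)) ≡ ∑ (cube k n) (λ z → h z (restrict J z))
  ∑-merge [] h = +-identityʳ _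
  ∑-merge {k} {suc n} (true ∷ J) h = begin
    ∑ (cube k (falses J)) (λ y → ∑ (cube k (suc (trues J))) (λ x → h (merge (true ∷ J) x y) x))
      ≡⟨ ∑-cong (cube k (falses J)) (λ y → ∑-cube-suc (trues J) _) ⟩
    ∑ (cube k (falses J)) (λ y → ∑ (cube k (trues J)) (λ x → ∑ (allFin k) (λ i → h (i ∷ merge J x y) (i ∷ x))))
      ≡⟨ ∑-cong (cube k (falses J)) (λ y → ∑-comm (cube k (trues J)) (allFin k) _) ⟩
    ∑ (cube k (falses J)) (λ y → ∑ (allFin k) (λ i → ∑ (cube k (trues J)) (λ x → h (i ∷ merge J x y) (i ∷ x))))
      ≡⟨ ∑-comm (cube k (falses J)) (allFin k) _ ⟩
    ∑ (allFin k) (λ i → ∑ (cube k (falses J)) (λ y → ∑ (cube k (trues J)) (λ x → h (i ∷ merge J x y) (i ∷ x))))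
      ≡⟨ ∑-cong (allFin k) (λ i → ∑-merge J (λ z x → h (i ∷ z) (i ∷ x))) ⟩
    ∑ (allFin k) (λ i → ∑ (cube k n) (λ z → h (i ∷ z) (i ∷ restrict J z)))
      ≡⟨ ∑-comm (allFin k) (cube k n) _ ⟩
    ∑ (cube k n) (λ z → ∑ (allFin k) (λ i → h (i ∷ z) (i ∷ restrict J z)))
      ≡⟨ sym (∑-cube-suc n _) ⟩
    ∑ (cube k (suc n)) (λ z → h z (restrict (true ∷ J) z)) ∎
    where open ≡-Reasoning
  ∑-merge {k} {suc n} (false ∷ J) h = begin
    ∑ (cube k (suc (falses J))) (λ y → ∑ (cube k (trues J)) (λ x → h (merge (false ∷ J) x y) x))
      ≡⟨ ∑-cube-suc (falses J) _ ⟩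
    ∑ (cube k (falses J)) (λ y → ∑ (allFin k) (λ i → ∑ (cube k (trues J)) (λ x → h (i ∷ merge J x y) x)))
      ≡⟨ ∑-comm (cube k (falses J)) (allFin k) _ ⟩
    ∑ (allFin k) (λ i → ∑ (cube k (falses J)) (λ y → ∑ (cube k (trues J)) (λ x → h (i ∷ merge J x y) x)))
      ≡⟨ ∑-cong (allFin k) (λ i → ∑-merge J (λ z x → h (i ∷ z) x)) ⟩
    ∑ (allFin k) (λ i → ∑ (cube k n) (λ z → h (i ∷ z) (restrict J z)))
      ≡⟨ ∑-comm (allFin k) (cube k n) _ ⟩
    ∑ (cube k n) (λ z → ∑ (allFin k) (λ i → h (i ∷ z) (restrict J z)))
      ≡⟨ sym (∑-cube-suc n _) ⟩
    ∑ (cube k (suc n)) (λ z → h z (restrict (false ∷ J) z)) ∎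
    where open ≡-Reasoning

  occ-merge : ∀ {k n} (j : Fin k) (J : Subset n) (x : Vec (Fin k) (trues J)) (y : Vec (Fin k) (falses J)) →
    occ j (merge J x y) ≡ occ j x + occ j y
  occ-merge j [] [] [] = refl
  occ-merge j (true ∷ J) (a ∷ x) y rewrite occ-∷ j a (merge J x y) | occ-∷ j a x | occ-merge j J x y =
    sym (+-assoc (𝟙 (a ≟ᵇ j)) (occ j x) (occ j y))
  occ-merge j (false ∷ J) x (b ∷ y) rewrite occ-∷ j b (merge J x y) | occ-∷ j b y | occ-merge j J x y =
    trans (sym (+-assoc (𝟙 (b ≟ᵇ j)) _ _)) (trans (cong (_+ occ j y) (+-comm (𝟙 (b ≟ᵇ j)) (occ j x))) (+-assoc (occ j x) _ _))


module TypeCounts where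

  open import Data.Nat using (ℕ; zero; suc; _+_; _*_; _!)
  open import Data.Nat.Properties using (+-identityʳ; *-zeroʳ; *-assoc; *-distribˡ-+; suc-injective; 0≢1+n)
  open import Data.Bool using (Bool; true; false; if_then_else_)
  open import Data.Fin using (Fin)
  open import Data.Vec as Vec using (Vec; []; _∷_; _[_]≔_)
  open import Data.Vec.Properties using (lookup∘update; lookup∘update′; []≔-idempotent; []≔-lookup; lookup-replicate)
  open import Data.List using (List; []; _∷_; length)
  open import Function using (_⇔_; mk⇔; Equivalence)
  open import Relation.Binary.PropositionalEquality
  open import Data.Nat.Solver using (module +-*-Solver)
  open +-*-Solver using (solve; _:+_; _:*_; _:=_)
  open import Defs
  open FiniteSums
  open Words
  open Restriction

  subsets : (n : ℕ) → List (Subset n)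
  subsets = allVecs (true ∷ false ∷ [])

  restrictionsOfType : ∀ {k n} → Vec (Fin k) n → Vec ℕ k → ℕ
  restrictionsOfType {n = n} z a = ∑ (subsets n) (λ J → 𝟙 (vecEqᵇ a (typeOf (restrict J z))))

  -- falling c b = c (c - 1) ⋯ (c - b + 1), through the recurrence (c + 1)↓(b + 1) = c↓(b + 1) + (b + 1) · c↓b
  falling : ℕ → ℕ → ℕ
  falling zero zero = 1
  falling zero (suc b) = 0
  falling (suc c) zero = 1
  falling (suc c) (suc b) = falling c (suc b) + suc b * falling c b

  falling-0 : ∀ c → falling c 0 ≡ 1
  falling-0 zero = refl
  falling-0 (suc c) = refl

  factorials : ∀ {k} → Vec ℕ k → ℕ
  factorials a = ∏ᶠ (λ j → Vec.lookup a j !)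

  vecEqᵇ⇔≡ : ∀ {k} {a b : Vec ℕ k} → (vecEqᵇ a b ≡ true) ⇔ (a ≡ b)
  vecEqᵇ⇔≡ {a = a} {b} = mk⇔ (vecEqᵇ⇒≡ a b) (λ { refl → vecEqᵇ-refl a })

  bool-ext : ∀ {b c : Bool} → (b ≡ true) ⇔ (c ≡ true) → b ≡ c
  bool-ext {true} {true} _ = refl
  bool-ext {true} {false} b⇔c = sym (Equivalence.to b⇔c refl)
  bool-ext {false} {true} b⇔c = Equivalence.from b⇔c refl
  bool-ext {false} {false} _ = refl

  vecEqᵇ-cong-⇔ : ∀ {k} {a b c d : Vec ℕ k} → (a ≡ b) ⇔ (c ≡ d) → vecEqᵇ a b ≡ vecEqᵇ c d
  vecEqᵇ-cong-⇔ a≡b⇔c≡d = bool-ext (mk⇔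
    (λ e → Equivalence.from vecEqᵇ⇔≡ (Equivalence.to a≡b⇔c≡d (Equivalence.to vecEqᵇ⇔≡ e)))
    (λ e → Equivalence.from vecEqᵇ⇔≡ (Equivalence.from a≡b⇔c≡d (Equivalence.to vecEqᵇ⇔≡ e))))

  typeOf-[] : ∀ k → typeOf {k} [] ≡ Vec.replicate k 0
  typeOf-[] k = lookup-ext _ _ (λ j → trans (lookup-typeOf [] j) (sym (lookup-replicate j 0)))

  typeOf-∷ : ∀ {k m} (i : Fin k) (x : Vec (Fin k) m) → typeOf (i ∷ x) ≡ typeOf x [ i ]≔ suc (Vec.lookup (typeOf x) i)
  typeOf-∷ i x = lookup-ext _ _ pointwise
    where
    pointwise : ∀ j → Vec.lookup (typeOf (i ∷ x)) j ≡ Vec.lookup (typeOf x [ i ]≔ suc (Vec.lookup (typeOf x) i)) j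
    pointwise j with j ≟ᵇ i in j≟i
    ... | true rewrite ≟ᵇ⇒≡ j≟i = trans (lookup-typeOf (i ∷ x) i) (trans (occ-∷-≡ i x)
                                    (sym (trans (lookup∘update i (typeOf x) _) (cong suc (lookup-typeOf x i)))))
    ... | false = trans (lookup-typeOf (i ∷ x) j) (trans (occ-∷-≢ i j x j≟i)
                    (sym (trans (lookup∘update′ (≟ᵇ⇒≢ j≟i) (typeOf x) _) (lookup-typeOf x j))))

  ≡-[]≔-suc⇔ : ∀ {k} (a t : Vec ℕ k) i {b} → Vec.lookup a i ≡ suc b →
    (a ≡ t [ i ]≔ suc (Vec.lookup t i)) ⇔ (a [ i ]≔ b ≡ t)
  ≡-[]≔-suc⇔ a t i {b} aᵢ≡1+b = mk⇔ to from
    where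
    to : a ≡ t [ i ]≔ suc (Vec.lookup t i) → a [ i ]≔ b ≡ t
    to refl = begin
      (t [ i ]≔ suc tᵢ) [ i ]≔ b ≡⟨ []≔-idempotent t i ⟩
      t [ i ]≔ b                 ≡⟨ cong (t [ i ]≔_) (suc-injective (trans (sym aᵢ≡1+b) (lookup∘update i t (suc tᵢ)))) ⟩
      t [ i ]≔ tᵢ                ≡⟨ []≔-lookup t i ⟩
      t                          ∎
      where
      open ≡-Reasoning
      tᵢ = Vec.lookup t i
    from : a [ i ]≔ b ≡ t → a ≡ t [ i ]≔ suc (Vec.lookup t i)
    from refl = begin
      a                                                   ≡⟨ sym ([]≔-lookup a i) ⟩
      a [ i ]≔ Vec.lookup a i                             ≡⟨ cong (a [ i ]≔_) aᵢ≡1+b ⟩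
      a [ i ]≔ suc b                                      ≡⟨ sym ([]≔-idempotent a i) ⟩
      (a [ i ]≔ b) [ i ]≔ suc b                           ≡⟨ cong (λ c → (a [ i ]≔ b) [ i ]≔ suc c) (sym (lookup∘update i a b)) ⟩
      (a [ i ]≔ b) [ i ]≔ suc (Vec.lookup (a [ i ]≔ b) i) ∎
      where open ≡-Reasoning

  vecEqᵇ-typeOf-∷-suc : ∀ {k m} (a : Vec ℕ k) i (x : Vec (Fin k) m) {b} → Vec.lookup a i ≡ suc b →
    vecEqᵇ a (typeOf (i ∷ x)) ≡ vecEqᵇ (a [ i ]≔ b) (typeOf x)
  vecEqᵇ-typeOf-∷-suc a i x aᵢ≡1+b rewrite typeOf-∷ i x = vecEqᵇ-cong-⇔ (≡-[]≔-suc⇔ a (typeOf x) i aᵢ≡1+b)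

  vecEqᵇ-typeOf-∷-zero : ∀ {k m} (a : Vec ℕ k) i (x : Vec (Fin k) m) → Vec.lookup a i ≡ 0 → vecEqᵇ a (typeOf (i ∷ x)) ≡ false
  vecEqᵇ-typeOf-∷-zero a i x aᵢ≡0 = vecEqᵇ-false a (typeOf (i ∷ x)) i
    (λ e → 0≢1+n (trans (sym aᵢ≡0) (trans e (trans (lookup-typeOf (i ∷ x) i) (occ-∷-≡ i x)))))

  restrictionsOfType-∷ : ∀ {k n} (i : Fin k) (z : Vec (Fin k) n) a →
    restrictionsOfType (i ∷ z) a ≡ ∑ (subsets n) (λ J → 𝟙 (vecEqᵇ a (typeOf (i ∷ restrict J z)))) + restrictionsOfType z a
  restrictionsOfType-∷ {n = n} i z a =
    trans (∑-concatMap _ (subsets n) _) (trans (∑-cong (subsets n) (λ J → cong (𝟙 (vecEqᵇ a (typeOf (i ∷ restrict J z))) +_) (+-identityʳ _)))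
      (∑-+ (subsets n) _ _))

  ∏ᶠ-off : ∀ {k} → Fin k → (Fin k → ℕ) → ℕ
  ∏ᶠ-off i f = ∏ᶠ (λ j → if j ≟ᵇ i then 1 else f j)

  ∏ᶠ-off-cong : ∀ {k} i {f g : Fin k → ℕ} → (∀ j → j ≟ᵇ i ≡ false → f j ≡ g j) → ∏ᶠ-off i f ≡ ∏ᶠ-off i g
  ∏ᶠ-off-cong i {f} {g} f≡g = ∏ᶠ-cong pointwise
    where
    pointwise : ∀ j → (if j ≟ᵇ i then 1 else f j) ≡ (if j ≟ᵇ i then 1 else g j)
    pointwise j with j ≟ᵇ i in j≟i
    ... | true = refl
    ... | false = f≡g j j≟i

  factorials-[]≔ : ∀ {k} (a : Vec ℕ k) i {b} → Vec.lookup a i ≡ suc b → factorials a ≡ suc b * factorials (a [ i ]≔ b)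
  factorials-[]≔ a i {b} aᵢ≡1+b = begin
    factorials a                                                     ≡⟨ ∏ᶠ-split _ i ⟩
    Vec.lookup a i ! * ∏ᶠ-off i (λ j → Vec.lookup a j !)             ≡⟨ cong₂ (λ c r → c ! * r) aᵢ≡1+b (∏ᶠ-off-cong i off-i) ⟩
    suc b ! * ∏ᶠ-off i (λ j → Vec.lookup a′ j !)                     ≡⟨ *-assoc (suc b) (b !) _ ⟩
    suc b * (b ! * ∏ᶠ-off i (λ j → Vec.lookup a′ j !))               ≡⟨ cong (λ c → suc b * (c ! * ∏ᶠ-off i (λ j → Vec.lookup a′ j !))) (sym (lookup∘update i a b)) ⟩
    suc b * (Vec.lookup a′ i ! * ∏ᶠ-off i (λ j → Vec.lookup a′ j !)) ≡⟨ cong (suc b *_) (sym (∏ᶠ-split _ i)) ⟩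
    suc b * factorials a′                                            ∎
    where
    open ≡-Reasoning
    a′ = a [ i ]≔ b
    off-i : ∀ j → j ≟ᵇ i ≡ false → Vec.lookup a j ! ≡ Vec.lookup a′ j !
    off-i j j≟i = cong _! (sym (lookup∘update′ (≟ᵇ⇒≢ j≟i) a b))

  factorials*𝟙[≡0] : ∀ {k} (a : Vec ℕ k) → factorials a * 𝟙 (vecEqᵇ a (Vec.replicate k 0)) ≡ ∏ᶠ (λ j → falling 0 (Vec.lookup a j))
  factorials*𝟙[≡0] [] = refl
  factorials*𝟙[≡0] (zero ∷ a) =
    trans (cong (_* 𝟙 (vecEqᵇ a (Vec.replicate _ 0))) (+-identityʳ (factorials a))) (trans (factorials*𝟙[≡0] a) (sym (+-identityʳ _)))
  factorials*𝟙[≡0] (suc c ∷ a) = *-zeroʳ (factorials (suc c ∷ a))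

  ∏falling : ∀ {k n} → Vec (Fin k) n → Vec ℕ k → ℕ
  ∏falling z a = ∏ᶠ (λ j → falling (occ j z) (Vec.lookup a j))

  FallingIdentity : ∀ {k n} → Vec (Fin k) n → Set
  FallingIdentity z = ∀ a → factorials a * restrictionsOfType z a ≡ ∏falling z a

  FallingIdentity-[] : ∀ k → FallingIdentity {k} []
  FallingIdentity-[] k a = begin
    factorials a * (𝟙 (vecEqᵇ a (typeOf {k} [])) + 0) ≡⟨ cong (factorials a *_) (+-identityʳ _) ⟩
    factorials a * 𝟙 (vecEqᵇ a (typeOf {k} []))       ≡⟨ cong (λ t → factorials a * 𝟙 (vecEqᵇ a t)) (typeOf-[] k) ⟩
    factorials a * 𝟙 (vecEqᵇ a (Vec.replicate k 0))   ≡⟨ factorials*𝟙[≡0] a ⟩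
    ∏ᶠ (λ j → falling 0 (Vec.lookup a j))             ∎
    where open ≡-Reasoning

  FallingIdentity-∷-zero : ∀ {k n} i (z : Vec (Fin k) n) → FallingIdentity z →
    ∀ a → Vec.lookup a i ≡ 0 → factorials a * restrictionsOfType (i ∷ z) a ≡ ∏falling (i ∷ z) a
  FallingIdentity-∷-zero {n = n} i z IH a aᵢ≡0 = begin
    factorials a * restrictionsOfType (i ∷ z) a   ≡⟨ cong (factorials a *_) (restrictionsOfType-∷ i z a) ⟩
    factorials a * (∑ (subsets n) (λ J → 𝟙 (vecEqᵇ a (typeOf (i ∷ restrict J z)))) + restrictionsOfType z a)
      ≡⟨ cong (λ s → factorials a * (s + restrictionsOfType z a))
              (trans (∑-cong (subsets n) (λ J → cong 𝟙 (vecEqᵇ-typeOf-∷-zero a i (restrict J z) aᵢ≡0)))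
                     (trans (∑-const (subsets n) 0) (*-zeroʳ (length (subsets n))))) ⟩
    factorials a * restrictionsOfType z a ≡⟨ IH a ⟩
    ∏falling z a                          ≡⟨ ∏ᶠ-cong pointwise ⟩
    ∏falling (i ∷ z) a                    ∎
    where
    open ≡-Reasoning
    pointwise : ∀ j → falling (occ j z) (Vec.lookup a j) ≡ falling (occ j (i ∷ z)) (Vec.lookup a j)
    pointwise j with j ≟ᵇ i in j≟i
    ... | true rewrite ≟ᵇ⇒≡ j≟i | aᵢ≡0 = trans (falling-0 (occ i z)) (sym (falling-0 (occ i (i ∷ z))))
    ... | false = cong (λ c → falling c (Vec.lookup a j)) (sym (occ-∷-≢ i j z j≟i))

  ∏falling-∷ : ∀ {k n} i (z : Vec (Fin k) n) a {b} → Vec.lookup a i ≡ suc b →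
    suc b * ∏falling z (a [ i ]≔ b) + ∏falling z a ≡ ∏falling (i ∷ z) a
  ∏falling-∷ i z a {b} aᵢ≡1+b = begin
    suc b * ∏falling z a′ + ∏falling z a
      ≡⟨ cong₂ _+_ (cong (suc b *_) (∏ᶠ-split _ i)) (∏ᶠ-split _ i) ⟩
    suc b * (falling c (Vec.lookup a′ i) * ∏ᶠ-off i (λ j → falling (occ j z) (Vec.lookup a′ j)))
      + falling c (Vec.lookup a i) * rest
      ≡⟨ cong₂ (λ u r → suc b * (falling c u * r) + falling c (Vec.lookup a i) * rest) (lookup∘update i a b) rest-a′ ⟩
    suc b * (falling c b * rest) + falling c (Vec.lookup a i) * rest
      ≡⟨ cong (λ v → suc b * (falling c b * rest) + falling c v * rest) aᵢ≡1+b ⟩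
    suc b * (falling c b * rest) + falling c (suc b) * rest
      ≡⟨ Pascal (suc b) (falling c b) (falling c (suc b)) rest ⟩
    falling (suc c) (suc b) * rest
      ≡⟨ cong₂ (λ u v → falling u v * rest) (sym (occ-∷-≡ i z)) (sym aᵢ≡1+b) ⟩
    falling (occ i (i ∷ z)) (Vec.lookup a i) * rest
      ≡⟨ cong (falling (occ i (i ∷ z)) (Vec.lookup a i) *_) (sym rest-∷) ⟩
    falling (occ i (i ∷ z)) (Vec.lookup a i) * ∏ᶠ-off i (λ j → falling (occ j (i ∷ z)) (Vec.lookup a j))
      ≡⟨ sym (∏ᶠ-split _ i) ⟩
    ∏falling (i ∷ z) a ∎
    where
    open ≡-Reasoning
    a′ = a [ i ]≔ b
    c = occ i z
    rest = ∏ᶠ-off i (λ j → falling (occ j z) (Vec.lookup a j))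
    rest-a′ : ∏ᶠ-off i (λ j → falling (occ j z) (Vec.lookup a′ j)) ≡ rest
    rest-a′ = ∏ᶠ-off-cong i (λ j j≟i → cong (falling (occ j z)) (lookup∘update′ (≟ᵇ⇒≢ j≟i) a b))
    rest-∷ : ∏ᶠ-off i (λ j → falling (occ j (i ∷ z)) (Vec.lookup a j)) ≡ rest
    rest-∷ = ∏ᶠ-off-cong i (λ j j≟i → cong (λ c → falling c (Vec.lookup a j)) (occ-∷-≢ i j z j≟i))
    Pascal : ∀ s f g r → s * (f * r) + g * r ≡ (g + s * f) * r
    Pascal = solve 4 (λ s f g r → s :* (f :* r) :+ g :* r := (g :+ s :* f) :* r) refl

  FallingIdentity-∷-suc : ∀ {k n} i (z : Vec (Fin k) n) → FallingIdentity z →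
    ∀ a {b} → Vec.lookup a i ≡ suc b → factorials a * restrictionsOfType (i ∷ z) a ≡ ∏falling (i ∷ z) a
  FallingIdentity-∷-suc {n = n} i z IH a {b} aᵢ≡1+b = begin
    factorials a * restrictionsOfType (i ∷ z) a       ≡⟨ cong (factorials a *_) (restrictionsOfType-∷ i z a) ⟩
    factorials a * (∑ (subsets n) (λ J → 𝟙 (vecEqᵇ a (typeOf (i ∷ restrict J z)))) + restrictionsOfType z a)
      ≡⟨ cong (λ s → factorials a * (s + restrictionsOfType z a))
              (∑-cong (subsets n) (λ J → cong 𝟙 (vecEqᵇ-typeOf-∷-suc a i (restrict J z) aᵢ≡1+b))) ⟩
    factorials a * (restrictionsOfType z a′ + restrictionsOfType z a)
      ≡⟨ *-distribˡ-+ (factorials a) _ _ ⟩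
    factorials a * restrictionsOfType z a′ + factorials a * restrictionsOfType z a
      ≡⟨ cong (λ f → f * restrictionsOfType z a′ + factorials a * restrictionsOfType z a) (factorials-[]≔ a i aᵢ≡1+b) ⟩
    suc b * factorials a′ * restrictionsOfType z a′ + factorials a * restrictionsOfType z a
      ≡⟨ cong₂ _+_ (trans (*-assoc (suc b) (factorials a′) _) (cong (suc b *_) (IH a′))) (IH a) ⟩
    suc b * ∏falling z a′ + ∏falling z a
      ≡⟨ ∏falling-∷ i z a aᵢ≡1+b ⟩
    ∏falling (i ∷ z) a ∎
    where
    open ≡-Reasoning
    a′ = a [ i ]≔ b

  -- #{J : type(z|J) = a} = ∏ⱼ C(cⱼ, aⱼ) with cⱼ = occ j z: J must contain exactly aⱼ of the cⱼ positions carrying j.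
  factorials*restrictionsOfType : ∀ {k n} (z : Vec (Fin k) n) → FallingIdentity z
  factorials*restrictionsOfType {k} [] = FallingIdentity-[] k
  factorials*restrictionsOfType (i ∷ z) a with Vec.lookup a i in aᵢ
  ... | zero = FallingIdentity-∷-zero i z (factorials*restrictionsOfType z) a aᵢ
  ... | suc b = FallingIdentity-∷-suc i z (factorials*restrictionsOfType z) a aᵢ


module FallingBounds where

  open import Data.Nat using (ℕ; zero; suc; _+_; _*_; _^_; _≤_; _∸_; z≤n)
  open import Data.Nat.Properties
  open import Data.Fin using (Fin)
  open import Data.Vec as Vec using (Vec)
  open import Relation.Nullary using (yes; no)
  open import Relation.Binary.PropositionalEquality
  open import Data.Nat.Solver using (module +-*-Solver)
  open +-*-Solver using (solve; _:+_; _:*_; con; _:=_)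
  open FiniteSums
  open Words
  open TypeCounts

  *-^-distrib : ∀ x y n → (x * y) ^ n ≡ x ^ n * y ^ n
  *-^-distrib x y zero = refl
  *-^-distrib x y (suc n) rewrite *-^-distrib x y n =
    solve 4 (λ x y a b → (x :* y) :* (a :* b) := (x :* a) :* (y :* b)) refl x y (x ^ n) (y ^ n)

  +-^-upper : ∀ m x y → (x + y) ^ suc m ≤ x ^ suc m + suc m * y * (x + y) ^ m
  +-^-upper zero x y = ≤-reflexive (solve 2 (λ x y → (x :+ y) :* con 1 := x :* con 1 :+ (y :+ con 0) :* con 1) refl x y)
  +-^-upper (suc m) x y = begin
    (x + y) * (x + y) ^ suc m                                             ≤⟨ *-monoʳ-≤ (x + y) (+-^-upper m x y) ⟩
    (x + y) * (x ^ suc m + suc m * y * (x + y) ^ m)                       ≡⟨ expand x y (x ^ suc m) (suc m) ((x + y) ^ m) ⟩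
    x ^ suc (suc m) + (y * x ^ suc m + suc m * y * (x + y) ^ suc m)       ≤⟨ +-monoʳ-≤ (x ^ suc (suc m)) (+-monoˡ-≤ _ (*-monoʳ-≤ y (^-monoˡ-≤ (suc m) (m≤m+n x y)))) ⟩
    x ^ suc (suc m) + (y * (x + y) ^ suc m + suc m * y * (x + y) ^ suc m) ≡⟨ cong (x ^ suc (suc m) +_) (collect y ((x + y) ^ suc m) (suc m)) ⟩
    x ^ suc (suc m) + suc (suc m) * y * (x + y) ^ suc m                   ∎
    where
    open ≤-Reasoning
    expand : ∀ x y a s t → (x + y) * (a + s * y * t) ≡ x * a + (y * a + s * y * ((x + y) * t))
    expand = solve 5 (λ x y a s t → (x :+ y) :* (a :+ s :* y :* t) := x :* a :+ (y :* a :+ s :* y :* ((x :+ y) :* t))) refl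
    collect : ∀ y t s → y * t + s * y * t ≡ (1 + s) * y * t
    collect = solve 3 (λ y t s → y :* t :+ s :* y :* t := (con 1 :+ s) :* y :* t) refl

  suc-^-lower : ∀ b x → x ^ suc b + suc b * x ^ b ≤ suc x ^ suc b
  suc-^-lower zero x = ≤-reflexive (solve 1 (λ x → x :* con 1 :+ (con 1 :+ con 0) :* con 1 := (con 1 :+ x) :* con 1) refl x)
  suc-^-lower (suc b) x = begin
    x * (x * x ^ b) + suc (suc b) * (x * x ^ b)                 ≤⟨ m≤m+n _ (suc b * x ^ b) ⟩
    x * (x * x ^ b) + suc (suc b) * (x * x ^ b) + suc b * x ^ b ≡⟨ factor x (x ^ b) b ⟩
    suc x * (x ^ suc b + suc b * x ^ b)                         ≤⟨ *-monoʳ-≤ (suc x) (suc-^-lower b x) ⟩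
    suc x ^ suc (suc b)                                         ∎
    where
    open ≤-Reasoning
    factor : ∀ x a c → x * (x * a) + (2 + c) * (x * a) + (1 + c) * a ≡ (1 + x) * (x * a + (1 + c) * a)
    factor = solve 3 (λ x a c → x :* (x :* a) :+ (con 2 :+ c) :* (x :* a) :+ (con 1 :+ c) :* a
                                := (con 1 :+ x) :* (x :* a :+ (con 1 :+ c) :* a)) refl

  falling≤^ : ∀ c b → falling c b ≤ c ^ b
  falling≤^ zero zero = ≤-refl
  falling≤^ zero (suc b) = z≤n
  falling≤^ (suc c) zero = ≤-refl
  falling≤^ (suc c) (suc b) = begin
    falling c (suc b) + suc b * falling c b ≤⟨ +-mono-≤ (falling≤^ c (suc b)) (*-monoʳ-≤ (suc b) (falling≤^ c b)) ⟩
    c ^ suc b + suc b * c ^ b               ≤⟨ suc-^-lower b c ⟩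
    suc c ^ suc b                           ∎
    where open ≤-Reasoning

  ∸^≤falling : ∀ c b → (c ∸ b) ^ b ≤ falling c b
  ∸^≤falling zero zero = ≤-refl
  ∸^≤falling zero (suc b) = z≤n
  ∸^≤falling (suc c) zero = ≤-refl
  ∸^≤falling (suc c) (suc b) with c ≤? b
  ... | yes c≤b rewrite m≤n⇒m∸n≡0 c≤b = z≤n
  ... | no c≰b = begin
    (c ∸ b) ^ suc b                             ≡⟨ cong (_^ suc b) (sym c∸b≡w+1) ⟩
    (w + 1) ^ suc b                             ≤⟨ +-^-upper b w 1 ⟩
    w ^ suc b + suc b * 1 * (w + 1) ^ b         ≡⟨ cong (λ v → w ^ suc b + suc b * 1 * v ^ b) c∸b≡w+1 ⟩
    w ^ suc b + suc b * 1 * (c ∸ b) ^ b         ≤⟨ +-mono-≤ (∸^≤falling c (suc b)) (*-monoʳ-≤ (suc b * 1) (∸^≤falling c b)) ⟩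
    falling c (suc b) + suc b * 1 * falling c b ≡⟨ cong (λ t → falling c (suc b) + t * falling c b) (*-identityʳ (suc b)) ⟩
    falling c (suc b) + suc b * falling c b     ∎
    where
    open ≤-Reasoning
    w = c ∸ suc b
    c∸b≡w+1 : w + 1 ≡ c ∸ b
    c∸b≡w+1 = trans (+-comm w 1) (sym (+-∸-assoc 1 (≰⇒> c≰b)))

  module _ {k n′} (z : Vec (Fin k) n′) (a : Vec ℕ k) {m} (∑a≡m : ∑ᶠ (Vec.lookup a) ≡ m) where

    k^m*∏falling : k ^ m * ∏falling z a ≡ ∏ᶠ (λ j → k ^ Vec.lookup a j * falling (occ j z) (Vec.lookup a j))
    k^m*∏falling = begin
      k ^ m * ∏falling z a                                               ≡⟨ cong (λ t → k ^ t * ∏falling z a) (sym ∑a≡m) ⟩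
      k ^ ∑ᶠ (Vec.lookup a) * ∏falling z a                               ≡⟨ cong (_* ∏falling z a) (sym (∏ᶠ-^ k (Vec.lookup a))) ⟩
      ∏ᶠ (λ j → k ^ Vec.lookup a j) * ∏falling z a                       ≡⟨ sym (∏ᶠ-* {k} _ _) ⟩
      ∏ᶠ (λ j → k ^ Vec.lookup a j * falling (occ j z) (Vec.lookup a j)) ∎
      where open ≡-Reasoning

    ∏falling-lower : ∀ n D → (∀ j → n ∸ D ≤ k * occ j z) → (n ∸ (D + k * m)) ^ m ≤ k ^ m * ∏falling z a
    ∏falling-lower n D lo = begin
      (n ∸ (D + k * m)) ^ m                                              ≡⟨ cong ((n ∸ (D + k * m)) ^_) (sym ∑a≡m) ⟩
      (n ∸ (D + k * m)) ^ ∑ᶠ (Vec.lookup a)                              ≡⟨ sym (∏ᶠ-^ _ (Vec.lookup a)) ⟩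
      ∏ᶠ (λ j → (n ∸ (D + k * m)) ^ Vec.lookup a j)                      ≤⟨ ∏ᶠ-mono factor ⟩
      ∏ᶠ (λ j → k ^ Vec.lookup a j * falling (occ j z) (Vec.lookup a j)) ≡⟨ sym k^m*∏falling ⟩
      k ^ m * ∏falling z a                                               ∎
      where
      open ≤-Reasoning
      factor : ∀ j → (n ∸ (D + k * m)) ^ Vec.lookup a j ≤ k ^ Vec.lookup a j * falling (occ j z) (Vec.lookup a j)
      factor j = begin
        (n ∸ (D + k * m)) ^ b ≤⟨ ^-monoˡ-≤ b base≤ ⟩
        (k * (c ∸ b)) ^ b     ≡⟨ *-^-distrib k (c ∸ b) b ⟩
        k ^ b * (c ∸ b) ^ b   ≤⟨ *-monoʳ-≤ (k ^ b) (∸^≤falling c b) ⟩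
        k ^ b * falling c b   ∎
        where
        b = Vec.lookup a j
        c = occ j z
        base≤ : n ∸ (D + k * m) ≤ k * (c ∸ b)
        base≤ = begin
          n ∸ (D + k * m) ≡⟨ sym (∸-+-assoc n D (k * m)) ⟩
          n ∸ D ∸ k * m   ≤⟨ ∸-mono (lo j) (*-monoʳ-≤ k (≤-trans (≤∑ᶠ (Vec.lookup a) j) (≤-reflexive ∑a≡m))) ⟩
          k * c ∸ k * b   ≡⟨ sym (*-distribˡ-∸ k c b) ⟩
          k * (c ∸ b)     ∎

    ∏falling-upper : ∀ n D → (∀ j → k * occ j z ≤ n + D) → k ^ m * ∏falling z a ≤ (n + D) ^ m
    ∏falling-upper n D hi = begin
      k ^ m * ∏falling z a                                               ≡⟨ k^m*∏falling ⟩
      ∏ᶠ (λ j → k ^ Vec.lookup a j * falling (occ j z) (Vec.lookup a j)) ≤⟨ ∏ᶠ-mono factor ⟩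
      ∏ᶠ (λ j → (n + D) ^ Vec.lookup a j)                                ≡⟨ ∏ᶠ-^ _ (Vec.lookup a) ⟩
      (n + D) ^ ∑ᶠ (Vec.lookup a)                                        ≡⟨ cong ((n + D) ^_) ∑a≡m ⟩
      (n + D) ^ m                                                        ∎
      where
      open ≤-Reasoning
      factor : ∀ j → k ^ Vec.lookup a j * falling (occ j z) (Vec.lookup a j) ≤ (n + D) ^ Vec.lookup a j
      factor j = begin
        k ^ b * falling c b ≤⟨ *-monoʳ-≤ (k ^ b) (falling≤^ c b) ⟩
        k ^ b * c ^ b       ≡⟨ sym (*-^-distrib k c b) ⟩
        (k * c) ^ b         ≤⟨ ^-monoˡ-≤ b (hi j) ⟩
        (n + D) ^ b         ∎
        where
        b = Vec.lookup a j
        c = occ j z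


module Concentration where

  open import Data.Nat using (ℕ; zero; suc; _+_; _*_; _^_; _≤_; _<_; _∸_; z≤n; _≤ᵇ_)
  open import Data.Nat.Properties
  open import Data.Bool using (Bool; true; false; _∨_; T)
  open import Data.Fin using (Fin)
  open import Data.Vec using (Vec)
  open import Data.List using (allFin; length)
  open import Data.Sum using (_⊎_; inj₁; inj₂)
  open import Relation.Nullary using (contradiction)
  open import Data.Product using (Σ; _,_)
  open import Relation.Binary.PropositionalEquality
  open import Data.Nat.Solver using (module +-*-Solver)
  open +-*-Solver using (solve; _:+_; _:*_; con; _:=_)
  open import Defs
  open FiniteSums
  open Words

  ≤ᵇ-true⇒≤ : ∀ {x y} → (x ≤ᵇ y) ≡ true → x ≤ y
  ≤ᵇ-true⇒≤ {x} {y} e = ≤ᵇ⇒≤ x y (subst T (sym e) _)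

  ≤ᵇ-false⇒> : ∀ {x y} → (x ≤ᵇ y) ≡ false → y < x
  ≤ᵇ-false⇒> e = ≰⇒> (λ le → subst T e (≤⇒≤ᵇ le))

  ≤⇒≤ᵇ-true : ∀ {x y} → x ≤ y → (x ≤ᵇ y) ≡ true
  ≤⇒≤ᵇ-true {x} {y} le with x ≤ᵇ y in e
  ... | true = refl
  ... | false = contradiction (≤⇒≤ᵇ le) (subst T e)

  ∑ᶠ-𝟙≟ᵇ-affine : ∀ {k} (j : Fin k) X Y → ∑ᶠ (λ i → 𝟙 (i ≟ᵇ j) * X + Y) ≡ X + k * Y
  ∑ᶠ-𝟙≟ᵇ-affine {k} j X Y = begin
    ∑ᶠ (λ i → 𝟙 (i ≟ᵇ j) * X + Y)                ≡⟨ ∑ᶠ-+ {k} (λ i → 𝟙 (i ≟ᵇ j) * X) (λ _ → Y) ⟩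
    ∑ᶠ (λ i → 𝟙 (i ≟ᵇ j) * X) + ∑ᶠ {k} (λ _ → Y) ≡⟨ cong₂ _+_ (trans (∑ᶠ-cong (λ i → *-comm (𝟙 (i ≟ᵇ j)) X)) (∑ᶠ-*ˡ {k} X _)) (∑ᶠ-const k Y) ⟩
    X * ∑ᶠ (λ i → 𝟙 (i ≟ᵇ j)) + k * Y            ≡⟨ cong (λ t → X * t + k * Y) (∑ᶠ-𝟙≟ᵇ j) ⟩
    X * 1 + k * Y                                ≡⟨ cong (_+ k * Y) (*-identityʳ X) ⟩
    X + k * Y                                    ∎
    where open ≡-Reasoning

  ∑-cube-letter : ∀ {k} n (j : Fin k) (f : ℕ → ℕ) → ∑ (cube k (suc n)) (λ z → f (occ j z)) ≡ ∑ (cube k n) (λ v → ∑ᶠ (λ i → f (𝟙 (i ≟ᵇ j) + occ j v)))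
  ∑-cube-letter {k} n j f = trans (∑-cube-suc n _) (∑-cong (cube k n) (λ v → trans (∑-allFin k _) (∑ᶠ-cong (λ i → cong f (occ-∷ j i v)))))

  ∑-k*occ : ∀ k n (j : Fin k) → ∑ (cube k n) (λ z → k * occ j z) ≡ n * k ^ n
  ∑-k*occ k zero j = trans (+-identityʳ _) (*-zeroʳ k)
  ∑-k*occ k (suc n) j = begin
    ∑ (cube k (suc n)) (λ z → k * occ j z)                          ≡⟨ ∑-cube-letter n j (k *_) ⟩
    ∑ (cube k n) (λ v → ∑ᶠ (λ i → k * (𝟙 (i ≟ᵇ j) + occ j v)))      ≡⟨ ∑-cong (cube k n) (λ v → trans (∑ᶠ-cong (λ i → distrib i v)) (∑ᶠ-𝟙≟ᵇ-affine j k (k * occ j v))) ⟩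
    ∑ (cube k n) (λ v → k + k * (k * occ j v))                      ≡⟨ ∑-+ (cube k n) _ _ ⟩
    ∑ (cube k n) (λ v → k) + ∑ (cube k n) (λ v → k * (k * occ j v)) ≡⟨ cong₂ _+_ (∑-const (cube k n) k) (∑-*ˡ (cube k n) k _) ⟩
    length (cube k n) * k + k * ∑ (cube k n) (λ v → k * occ j v)    ≡⟨ cong₂ (λ u v → u * k + k * v) (length-cube k n) (∑-k*occ k n j) ⟩
    k ^ n * k + k * (n * k ^ n)                                     ≡⟨ solve 3 (λ a k n → a :* k :+ k :* (n :* a) := (con 1 :+ n) :* (k :* a)) refl (k ^ n) k n ⟩
    suc n * k ^ suc n                                               ∎
    where
    open ≡-Reasoning
    distrib : ∀ i v → k * (𝟙 (i ≟ᵇ j) + occ j v) ≡ 𝟙 (i ≟ᵇ j) * k + k * occ j v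
    distrib i v = trans (*-distribˡ-+ k (𝟙 (i ≟ᵇ j)) (occ j v)) (cong (_+ k * occ j v) (*-comm k (𝟙 (i ≟ᵇ j))))

  ∑-[k*occ]²-suc : ∀ k n (j : Fin k) →
    ∑ (cube k (suc n)) (λ z → (k * occ j z) * (k * occ j z))
      ≡ k ^ n * (k * k) + 2 * k * (n * k ^ n) + k * ∑ (cube k n) (λ z → (k * occ j z) * (k * occ j z))
  ∑-[k*occ]²-suc k n j = begin
    ∑ (cube k (suc n)) (λ z → sq (occ j z))                   ≡⟨ ∑-cube-letter n j sq ⟩
    ∑ (cube k n) (λ v → ∑ᶠ (λ i → sq (𝟙 (i ≟ᵇ j) + occ j v)))
      ≡⟨ ∑-cong (cube k n) (λ v → trans (∑ᶠ-cong (λ i → sq-𝟙+ (i ≟ᵇ j) (occ j v))) (∑ᶠ-𝟙≟ᵇ-affine j _ _)) ⟩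
    ∑ (cube k n) (λ v → (k * k + 2 * k * (k * occ j v)) + k * sq (occ j v))
      ≡⟨ trans (∑-+ (cube k n) _ _) (cong (_+ ∑ (cube k n) (λ v → k * sq (occ j v))) (∑-+ (cube k n) _ _)) ⟩
    ∑ (cube k n) (λ v → k * k) + ∑ (cube k n) (λ v → 2 * k * (k * occ j v)) + ∑ (cube k n) (λ v → k * sq (occ j v))
      ≡⟨ cong₂ _+_ (cong₂ _+_ (trans (∑-const (cube k n) _) (cong (_* (k * k)) (length-cube k n)))
                              (trans (∑-*ˡ (cube k n) (2 * k) _) (cong (2 * k *_) (∑-k*occ k n j))))
                   (∑-*ˡ (cube k n) k _) ⟩
    k ^ n * (k * k) + 2 * k * (n * k ^ n) + k * ∑ (cube k n) (λ z → sq (occ j z)) ∎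
    where
    open ≡-Reasoning
    sq : ℕ → ℕ
    sq c = (k * c) * (k * c)
    sq-𝟙+ : ∀ b c → sq (𝟙 b + c) ≡ 𝟙 b * (k * k + 2 * k * (k * c)) + sq c
    sq-𝟙+ true c = solve 2 (λ k c → (k :* (con 1 :+ c)) :* (k :* (con 1 :+ c)) := con 1 :* (k :* k :+ con 2 :* k :* (k :* c)) :+ (k :* c) :* (k :* c)) refl k c
    sq-𝟙+ false c = solve 2 (λ k c → (k :* c) :* (k :* c) := con 0 :* (k :* k :+ con 2 :* k :* (k :* c)) :+ (k :* c) :* (k :* c)) refl k c

  -- ∑_z (k·occ j z - n)² = n (k - 1) kⁿ, in subtraction-free form
  ∑-[k*occ]² : ∀ k n (j : Fin k) → ∑ (cube k n) (λ z → (k * occ j z) * (k * occ j z)) + n * k ^ n ≡ k ^ n * (n * n + n * k)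
  ∑-[k*occ]² k zero j rewrite *-zeroʳ k = refl
  ∑-[k*occ]² k (suc n) j = +-cancelʳ-≡ (k * (n * k ^ n)) _ _ (begin
    ∑ (cube k (suc n)) sq + suc n * k ^ suc n + k * (n * k ^ n)
      ≡⟨ cong (λ t → t + suc n * k ^ suc n + k * (n * k ^ n)) (∑-[k*occ]²-suc k n j) ⟩
    k ^ n * (k * k) + 2 * k * (n * k ^ n) + k * Q + suc n * k ^ suc n + k * (n * k ^ n)
      ≡⟨ regroup (k ^ n) k n Q ⟩
    k ^ n * (k * k) + 2 * k * (n * k ^ n) + suc n * (k * k ^ n) + k * (Q + n * k ^ n)
      ≡⟨ cong (λ t → k ^ n * (k * k) + 2 * k * (n * k ^ n) + suc n * (k * k ^ n) + k * t) (∑-[k*occ]² k n j) ⟩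
    k ^ n * (k * k) + 2 * k * (n * k ^ n) + suc n * (k * k ^ n) + k * (k ^ n * (n * n + n * k))
      ≡⟨ close (k ^ n) k n ⟩
    k ^ suc n * (suc n * suc n + suc n * k) + k * (n * k ^ n) ∎)
    where
    open ≡-Reasoning
    sq : ∀ {n} → Vec (Fin k) n → ℕ
    sq z = (k * occ j z) * (k * occ j z)
    Q = ∑ (cube k n) sq
    regroup : ∀ a k n q → a * (k * k) + 2 * k * (n * a) + k * q + (1 + n) * (k * a) + k * (n * a)
                        ≡ a * (k * k) + 2 * k * (n * a) + (1 + n) * (k * a) + k * (q + n * a)
    regroup = solve 4 (λ a k n q → a :* (k :* k) :+ con 2 :* k :* (n :* a) :+ k :* q :+ (con 1 :+ n) :* (k :* a) :+ k :* (n :* a)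
                                := a :* (k :* k) :+ con 2 :* k :* (n :* a) :+ (con 1 :+ n) :* (k :* a) :+ k :* (q :+ n :* a)) refl
    close : ∀ a k n → a * (k * k) + 2 * k * (n * a) + (1 + n) * (k * a) + k * (a * (n * n + n * k))
                    ≡ (k * a) * ((1 + n) * (1 + n) + (1 + n) * k) + k * (n * a)
    close = solve 3 (λ a k n → a :* (k :* k) :+ con 2 :* k :* (n :* a) :+ (con 1 :+ n) :* (k :* a) :+ k :* (a :* (n :* n :+ n :* k))
                            := (k :* a) :* ((con 1 :+ n) :* (con 1 :+ n) :+ (con 1 :+ n) :* k) :+ k :* (n :* a)) refl

  far : ℕ → ℕ → ℕ → Bool
  far n D u = (u + D ≤ᵇ n) ∨ (n + D ≤ᵇ u)

  unbalanced : ∀ {k n′} → ℕ → ℕ → Vec (Fin k) n′ → Bool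
  unbalanced {k} n D z = anyᶠ (λ j → far n D (k * occ j z))

  ¬far⇒∸≤ : ∀ n D u → far n D u ≡ false → n ∸ D ≤ u
  ¬far⇒∸≤ n D u e with u + D ≤ᵇ n in e₁
  ... | false = m≤n+o⇒m∸n≤o n D (≤-trans (<⇒≤ (≤ᵇ-false⇒> e₁)) (≤-reflexive (+-comm u D)))

  ¬far⇒≤+ : ∀ n D u → far n D u ≡ false → u ≤ n + D
  ¬far⇒≤+ n D u e with u + D ≤ᵇ n | n + D ≤ᵇ u in e₂
  ... | false | false = <⇒≤ (≤ᵇ-false⇒> e₂)

  far⇒≤distance : ∀ n D u r → u + r ≡ n ⊎ n + r ≡ u → far n D u ≡ true → D ≤ r
  far⇒≤distance n D u r d e with u + D ≤ᵇ n in e₁ | n + D ≤ᵇ u in e₂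
  far⇒≤distance n D u r (inj₁ u+r≡n) e | true | _ = +-cancelˡ-≤ u D r (≤-trans (≤ᵇ-true⇒≤ e₁) (≤-reflexive (sym u+r≡n)))
  far⇒≤distance n D u r (inj₂ n+r≡u) e | true | _ =
    ≤-trans (+-cancelˡ-≤ u D 0 (≤-trans (≤ᵇ-true⇒≤ e₁) (≤-trans (m≤m+n n r) (≤-reflexive (trans n+r≡u (sym (+-identityʳ u))))))) z≤n
  far⇒≤distance n D u r (inj₁ u+r≡n) e | false | true =
    ≤-trans (+-cancelˡ-≤ n D 0 (≤-trans (≤ᵇ-true⇒≤ e₂) (≤-trans (m≤m+n u r) (≤-reflexive (trans u+r≡n (sym (+-identityʳ n))))))) z≤n
  far⇒≤distance n D u r (inj₂ n+r≡u) e | false | true = +-cancelˡ-≤ n D r (≤-trans (≤ᵇ-true⇒≤ e₂) (≤-reflexive (sym n+r≡u)))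

  distance : ∀ u n → Σ ℕ (λ r → u + r ≡ n ⊎ n + r ≡ u)
  distance u n with ≤-total u n
  ... | inj₁ u≤n = n ∸ u , inj₁ (m+[n∸m]≡n u≤n)
  ... | inj₂ n≤u = u ∸ n , inj₂ (m+[n∸m]≡n n≤u)

  distance-square : ∀ n u r → u + r ≡ n ⊎ n + r ≡ u → u * u + n * n ≡ r * r + 2 * n * u
  distance-square .(u + r) u r (inj₁ refl) = solve 2 (λ u r → u :* u :+ (u :+ r) :* (u :+ r) := r :* r :+ con 2 :* (u :+ r) :* u) refl u r
  distance-square n .(n + r) r (inj₂ refl) = solve 2 (λ n r → (n :+ r) :* (n :+ r) :+ n :* n := r :* r :+ con 2 :* n :* (n :+ r)) refl n r

  𝟙far*D²≤distance² : ∀ n D u r → u + r ≡ n ⊎ n + r ≡ u → 𝟙 (far n D u) * (D * D) ≤ r * r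
  𝟙far*D²≤distance² n D u r d with far n D u in e
  ... | true = ≤-trans (≤-reflexive (+-identityʳ (D * D))) (*-mono-≤ (far⇒≤distance n D u r d e) (far⇒≤distance n D u r d e))
  ... | false = z≤n

  -- D² [|u - n| ≥ D] ≤ (u - n)², in subtraction-free form
  𝟙far*D²≤ : ∀ n D u → 𝟙 (far n D u) * (D * D) + 2 * n * u ≤ u * u + n * n
  𝟙far*D²≤ n D u with distance u n
  ... | r , d = ≤-trans (+-monoˡ-≤ (2 * n * u) (𝟙far*D²≤distance² n D u r d)) (≤-reflexive (sym (distance-square n u r d)))

  chebyshev-letter : ∀ k n D (j : Fin k) → ∑ (cube k n) (λ z → 𝟙 (far n D (k * occ j z)) * (D * D)) ≤ n * k * k ^ n
  chebyshev-letter k n D j = +-cancelʳ-≤ (2 * n * (n * k ^ n)) _ _ (begin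
    X + 2 * n * (n * k ^ n)                        ≡⟨ cong (λ t → X + 2 * n * t) (sym (∑-k*occ k n j)) ⟩
    X + 2 * n * ∑ (cube k n) (λ z → k * occ j z)   ≡⟨ cong (X +_) (sym (∑-*ˡ (cube k n) (2 * n) _)) ⟩
    X + ∑ (cube k n) (λ z → 2 * n * (k * occ j z)) ≡⟨ sym (∑-+ (cube k n) _ _) ⟩
    ∑ (cube k n) (λ z → 𝟙 (far n D (k * occ j z)) * (D * D) + 2 * n * (k * occ j z))
                                                       ≤⟨ ∑-mono (cube k n) (λ z → 𝟙far*D²≤ n D (k * occ j z)) ⟩
    ∑ (cube k n) (λ z → (k * occ j z) * (k * occ j z) + n * n) ≡⟨ ∑-+ (cube k n) _ _ ⟩
    Q + ∑ (cube k n) (λ z → n * n)                             ≡⟨ cong (Q +_) (trans (∑-const (cube k n) _) (cong (_* (n * n)) (length-cube k n))) ⟩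
    Q + k ^ n * (n * n)                                        ≤⟨ +-monoˡ-≤ (k ^ n * (n * n)) (m≤m+n Q (n * k ^ n)) ⟩
    Q + n * k ^ n + k ^ n * (n * n)                            ≡⟨ cong (_+ k ^ n * (n * n)) (∑-[k*occ]² k n j) ⟩
    k ^ n * (n * n + n * k) + k ^ n * (n * n)                  ≡⟨ solve 3 (λ a n k → a :* (n :* n :+ n :* k) :+ a :* (n :* n) := n :* k :* a :+ con 2 :* n :* (n :* a)) refl (k ^ n) n k ⟩
    n * k * k ^ n + 2 * n * (n * k ^ n)                        ∎)
    where
    open ≤-Reasoning
    X = ∑ (cube k n) (λ z → 𝟙 (far n D (k * occ j z)) * (D * D))
    Q = ∑ (cube k n) (λ z → (k * occ j z) * (k * occ j z))

  chebyshev : ∀ k n D → ∑ (cube k n) (λ z → 𝟙 (unbalanced n D z) * (D * D)) ≤ k * (n * k * k ^ n)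
  chebyshev k n D = begin
    ∑ (cube k n) (λ z → 𝟙 (unbalanced n D z) * (D * D))            ≤⟨ ∑-mono (cube k n) (λ z → *-monoˡ-≤ (D * D) (𝟙-anyᶠ (λ j → far′ j z))) ⟩
    ∑ (cube k n) (λ z → ∑ᶠ (λ j → 𝟙 (far′ j z)) * (D * D))         ≡⟨ ∑-cong (cube k n) (λ z → trans (*-comm _ (D * D)) (sym (∑ᶠ-*ˡ {k} (D * D) _))) ⟩
    ∑ (cube k n) (λ z → ∑ᶠ (λ j → D * D * 𝟙 (far′ j z)))           ≡⟨ ∑-cong (cube k n) (λ z → sym (∑-allFin k _)) ⟩
    ∑ (cube k n) (λ z → ∑ (allFin k) (λ j → D * D * 𝟙 (far′ j z))) ≡⟨ ∑-comm (cube k n) (allFin k) _ ⟩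
    ∑ (allFin k) (λ j → ∑ (cube k n) (λ z → D * D * 𝟙 (far′ j z))) ≡⟨ ∑-allFin k _ ⟩
    ∑ᶠ (λ j → ∑ (cube k n) (λ z → D * D * 𝟙 (far′ j z)))           ≤⟨ ∑ᶠ-mono (λ j → ≤-trans (≤-reflexive (∑-cong (cube k n) (λ z → *-comm (D * D) _))) (chebyshev-letter k n D j)) ⟩
    ∑ᶠ {k} (λ j → n * k * k ^ n)                                   ≡⟨ ∑ᶠ-const k _ ⟩
    k * (n * k * k ^ n)                                            ∎
    where
    open ≤-Reasoning
    far′ : ∀ j → Vec (Fin k) n → Bool
    far′ j z = far n D (k * occ j z)


module DoubleCounting where

  open import Data.Nat as ℕ using (ℕ; _*_; _^_; _≡ᵇ_)
  open import Data.Nat.Properties using (*-zeroʳ; ≡ᵇ⇒≡)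
  open import Data.Bool using (Bool; true; false; _∧_)
  open import Data.Fin using (Fin)
  open import Data.Vec as Vec using (Vec)
  open import Data.List.Relation.Unary.All as All using (All)
  open import Data.List.Relation.Unary.All.Properties using (all-filter)
  open import Relation.Nullary.Decidable using (T?)
  open import Function using (_∘_)
  open import Relation.Binary.PropositionalEquality
  open import Defs
  open FiniteSums
  open Words
  open Restriction
  open TypeCounts

  sliceSize : (k t : ℕ) → Vec ℕ k → ℕ
  sliceSize k t a = countL (λ x → vecEqᵇ a (typeOf x)) (cube k t)

  sliceHits : ∀ {k n} → (Vec (Fin k) n → Bool) → (J : Subset n) → Vec (Fin k) (falses J) → Vec ℕ k → ℕ
  sliceHits {k} A J y a = countL (λ x → A (merge J x y) ∧ vecEqᵇ a (typeOf x)) (cube k (trues J))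

  hits : (k n m : ℕ) → (Vec (Fin k) n → Bool) → Vec ℕ k → ℕ
  hits k n m A a = ∑ (subsetsOfSize n m) (λ J → ∑ (cube k (falses J)) (λ y → sliceHits A J y a))

  total : (k n m : ℕ) → Vec ℕ k → ℕ
  total k n m a = ∑ (subsetsOfSize n m) (λ J → ∑ (cube k (falses J)) (λ _ → sliceSize k (trues J) a))

  trues-subsetsOfSize : ∀ n m → All (λ J → trues J ≡ m) (subsetsOfSize n m)
  trues-subsetsOfSize n m = All.map (≡ᵇ⇒≡ _ m) (all-filter (T? ∘ (λ J → trues J ≡ᵇ m)) (subsets n))

  module _ {k : ℕ} (n m : ℕ) (a : Vec ℕ k) where

    weight : Vec (Fin k) n → ℕ
    weight z = ∑ (subsetsOfSize n m) (λ J → 𝟙 (vecEqᵇ a (typeOf (restrict J z))))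

    ∑-subsetsOfSize-merge : (h : Vec (Fin k) n → ∀ {t} → Vec (Fin k) t → ℕ) →
      ∑ (subsetsOfSize n m) (λ J → ∑ (cube k (falses J)) (λ y → ∑ (cube k (trues J)) (λ x → h (merge J x y) x)))
        ≡ ∑ (cube k n) (λ z → ∑ (subsetsOfSize n m) (λ J → h z (restrict J z)))
    ∑-subsetsOfSize-merge h = trans (∑-cong (subsetsOfSize n m) (λ J → ∑-merge J (λ z x → h z x))) (∑-comm (subsetsOfSize n m) (cube k n) _)

    hits≡∑weight : ∀ A → hits k n m A a ≡ ∑ (cube k n) (λ z → 𝟙 (A z) * weight z)
    hits≡∑weight A = begin
      hits k n m A a
        ≡⟨ ∑-cong S (λ J → ∑-cong (cube k (falses J)) (λ y → countL≡∑𝟙 _ (cube k (trues J)))) ⟩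
      ∑ S (λ J → ∑ (cube k (falses J)) (λ y → ∑ (cube k (trues J)) (λ x → 𝟙 (A (merge J x y) ∧ vecEqᵇ a (typeOf x)))))
        ≡⟨ ∑-subsetsOfSize-merge (λ z x → 𝟙 (A z ∧ vecEqᵇ a (typeOf x))) ⟩
      ∑ (cube k n) (λ z → ∑ S (λ J → 𝟙 (A z ∧ vecEqᵇ a (typeOf (restrict J z)))))
        ≡⟨ ∑-cong (cube k n) (λ z → trans (∑-cong S (λ J → 𝟙-∧ (A z) _)) (∑-*ˡ S (𝟙 (A z)) _)) ⟩
      ∑ (cube k n) (λ z → 𝟙 (A z) * weight z) ∎
      where
      open ≡-Reasoning
      S = subsetsOfSize n m

    total≡∑weight : total k n m a ≡ ∑ (cube k n) weight
    total≡∑weight = trans (∑-cong S (λ J → ∑-cong (cube k (falses J)) (λ y → countL≡∑𝟙 _ (cube k (trues J)))))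
                          (∑-subsetsOfSize-merge (λ z x → 𝟙 (vecEqᵇ a (typeOf x))))
      where S = subsetsOfSize n m

    total≡∑k^*sliceSize : total k n m a ≡ ∑ (subsetsOfSize n m) (λ J → k ^ falses J * sliceSize k (trues J) a)
    total≡∑k^*sliceSize = ∑-cong (subsetsOfSize n m) (λ J →
      trans (∑-const (cube k (falses J)) _) (cong (_* sliceSize k (trues J) a) (length-cube k (falses J))))

    -- a subset on which z has type a automatically has size m
    weight≡restrictionsOfType : ∑ᶠ (Vec.lookup a) ≡ m → ∀ z → weight z ≡ restrictionsOfType z a
    weight≡restrictionsOfType ∑a≡m z = trans (∑-filter (λ J → trues J ≡ᵇ m) (subsets n) _) (∑-cong (subsets n) pointwise)
      where
      pointwise : ∀ J → 𝟙 (trues J ≡ᵇ m) * 𝟙 (vecEqᵇ a (typeOf (restrict J z))) ≡ 𝟙 (vecEqᵇ a (typeOf (restrict J z)))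
      pointwise J with vecEqᵇ a (typeOf (restrict J z)) in e
      ... | false = *-zeroʳ (𝟙 (trues J ≡ᵇ m))
      ... | true = cong (λ b → 𝟙 b * 1) (subst (λ t → (t ≡ᵇ m) ≡ true) |J|≡m (≡ᵇ-refl m))
        where
        |J|≡m : m ≡ trues J
        |J|≡m = begin
          m                               ≡⟨ sym ∑a≡m ⟩
          ∑ᶠ (Vec.lookup a)               ≡⟨ sym (sum≡∑ᶠ a) ⟩
          Vec.sum a                       ≡⟨ cong Vec.sum (vecEqᵇ⇒≡ a _ e) ⟩
          Vec.sum (typeOf (restrict J z)) ≡⟨ sum-typeOf (restrict J z) ⟩
          trues J                         ∎
          where open ≡-Reasoning


module WeightBounds where

  open import Data.Nat using (ℕ; _+_; _*_; _^_; _≤_; _∸_; z≤n; _≤ᵇ_)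
  open import Data.Nat.Properties
  open import Data.Bool using (true; false; _∨_)
  open import Data.Bool.Properties using (∨-zeroʳ)
  open import Data.Fin using (Fin)
  open import Data.Vec as Vec using (Vec)
  open import Relation.Binary.PropositionalEquality
  open import Data.Nat.Solver using (module +-*-Solver)
  open +-*-Solver using (solve; _:+_; _:*_; _:=_)
  open import Defs
  open FiniteSums
  open Words
  open Restriction
  open TypeCounts
  open FallingBounds
  open Concentration
  open DoubleCounting

  -- If |k(cx + cy) - (t + f)| ≥ D with cx ≤ t, then |k cy - f| ≥ D - k t ≥ E.
  far-restrict : ∀ t f D E k cx cy → 1 ≤ k → cx ≤ t → E + k * t ≤ D → far (t + f) D (k * (cx + cy)) ≡ true → far f E (k * cy) ≡ true
  far-restrict t f D E k cx cy k≥1 cx≤t E+kt≤D h with k * (cx + cy) + D ≤ᵇ t + f in e₁ | t + f + D ≤ᵇ k * (cx + cy) in e₂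
  ... | true | _ = cong (_∨ (f + E ≤ᵇ k * cy)) (≤⇒≤ᵇ-true (+-cancelˡ-≤ t _ _ (begin
        t + (k * cy + E)            ≡⟨ solve 3 (λ t u e → t :+ (u :+ e) := u :+ (e :+ t)) refl t (k * cy) E ⟩
        k * cy + (E + t)            ≤⟨ +-mono-≤ (*-monoʳ-≤ k (m≤n+m cy cx)) (+-monoʳ-≤ E (≤-trans (≤-reflexive (sym (*-identityˡ t))) (*-monoˡ-≤ t k≥1))) ⟩
        k * (cx + cy) + (E + k * t) ≤⟨ +-monoʳ-≤ (k * (cx + cy)) E+kt≤D ⟩
        k * (cx + cy) + D           ≤⟨ ≤ᵇ-true⇒≤ e₁ ⟩
        t + f                       ∎)))
    where open ≤-Reasoning
  ... | false | true = trans (cong ((k * cy + E ≤ᵇ f) ∨_) (≤⇒≤ᵇ-true (+-cancelʳ-≤ (k * t) _ _ (begin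
        f + E + k * t   ≡⟨ +-assoc f E (k * t) ⟩
        f + (E + k * t) ≤⟨ +-monoʳ-≤ f E+kt≤D ⟩
        f + D           ≤⟨ +-monoˡ-≤ D (m≤n+m f t) ⟩
        t + f + D       ≤⟨ ≤ᵇ-true⇒≤ e₂ ⟩
        k * (cx + cy)   ≡⟨ *-distribˡ-+ k cx cy ⟩
        k * cx + k * cy ≤⟨ +-monoˡ-≤ (k * cy) (*-monoʳ-≤ k cx≤t) ⟩
        k * t + k * cy  ≡⟨ +-comm (k * t) (k * cy) ⟩
        k * cy + k * t            ∎)))) (∨-zeroʳ (k * cy + E ≤ᵇ f))
    where open ≤-Reasoning

  unbalanced-merge : ∀ {k n} m D E (J : Subset n) (x : Vec (Fin k) (trues J)) (y : Vec (Fin k) (falses J)) →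
    1 ≤ k → trues J ≡ m → E + k * m ≤ D → 𝟙 (unbalanced n D (merge J x y)) ≤ 𝟙 (unbalanced (falses J) E y)
  unbalanced-merge {k} {n} m D E J x y k≥1 refl E+km≤D = anyᶠ-mono _ _ pointwise
    where
    pointwise : ∀ j → far n D (k * occ j (merge J x y)) ≡ true → far (falses J) E (k * occ j y) ≡ true
    pointwise j h = far-restrict (trues J) (falses J) D E k (occ j x) (occ j y) k≥1 (occ≤length j x) E+km≤D
      (subst₂ (λ u v → far u D (k * v) ≡ true) (sym (trues+falses J)) (occ-merge j J x y) h)

  module Weights {k m : ℕ} (n : ℕ) (a : Vec ℕ k) (∑a≡m : ∑ᶠ (Vec.lookup a) ≡ m) (D : ℕ) where

    scale low high #unbalanced : ℕ
    scale = k ^ m * factorials a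
    low = (n ∸ (D + k * m)) ^ m
    high = (n + D) ^ m
    #unbalanced = ∑ (cube k n) (λ z → 𝟙 (unbalanced n D z))

    unbalancedWeight : ℕ
    unbalancedWeight = ∑ (cube k n) (λ z → 𝟙 (unbalanced n D z) * weight n m a z)

    scale*weight : ∀ z → scale * weight n m a z ≡ k ^ m * ∏falling z a
    scale*weight z = trans (*-assoc (k ^ m) (factorials a) (weight n m a z))
      (cong (k ^ m *_) (trans (cong (factorials a *_) (weight≡restrictionsOfType n m a ∑a≡m z)) (factorials*restrictionsOfType z a)))

    module _ (z : Vec (Fin k) n) (balanced : unbalanced n D z ≡ false) where

      private
        near : ∀ j → far n D (k * occ j z) ≡ false
        near = anyᶠ-false (λ j → far n D (k * occ j z)) balanced

      low≤scale*weight : low ≤ scale * weight n m a z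
      low≤scale*weight = ≤-trans (∏falling-lower z a ∑a≡m n D (λ j → ¬far⇒∸≤ n D _ (near j))) (≤-reflexive (sym (scale*weight z)))

      scale*weight≤high : scale * weight n m a z ≤ high
      scale*weight≤high = ≤-trans (≤-reflexive (scale*weight z)) (∏falling-upper z a ∑a≡m n D (λ j → ¬far⇒≤+ n D _ (near j)))

    low*#A≤ : ∀ A → low * countL A (cube k n) ≤ scale * hits k n m A a + low * #unbalanced
    low*#A≤ A = begin
      low * countL A (cube k n)                                                            ≡⟨ cong (low *_) (countL≡∑𝟙 A (cube k n)) ⟩
      low * ∑ (cube k n) (λ z → 𝟙 (A z))                                                   ≡⟨ sym (∑-*ˡ (cube k n) low _) ⟩
      ∑ (cube k n) (λ z → low * 𝟙 (A z))                                                   ≤⟨ ∑-mono (cube k n) pointwise ⟩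
      ∑ (cube k n) (λ z → scale * (𝟙 (A z) * weight n m a z) + low * 𝟙 (unbalanced n D z)) ≡⟨ ∑-+ (cube k n) _ _ ⟩
      ∑ (cube k n) (λ z → scale * (𝟙 (A z) * weight n m a z)) + ∑ (cube k n) (λ z → low * 𝟙 (unbalanced n D z))
        ≡⟨ cong₂ _+_ (trans (∑-*ˡ (cube k n) scale _) (cong (scale *_) (sym (hits≡∑weight n m a A)))) (∑-*ˡ (cube k n) low _) ⟩
      scale * hits k n m A a + low * #unbalanced      ∎
      where
      open ≤-Reasoning
      pointwise : ∀ z → low * 𝟙 (A z) ≤ scale * (𝟙 (A z) * weight n m a z) + low * 𝟙 (unbalanced n D z)
      pointwise z with unbalanced n D z in e | A z
      ... | true | b = ≤-trans (*-monoʳ-≤ low (𝟙≤1 b)) (m≤n+m (low * 1) _)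
      ... | false | false = ≤-trans (≤-reflexive (*-zeroʳ low)) z≤n
      ... | false | true = ≤-trans (≤-reflexive (*-identityʳ low))
                            (≤-trans (low≤scale*weight z e) (≤-trans (≤-reflexive (cong (scale *_) (sym (*-identityˡ (weight n m a z))))) (m≤m+n _ _)))

    scale*total≤ : scale * total k n m a ≤ k ^ n * high + scale * unbalancedWeight
    scale*total≤ = begin
      scale * total k n m a                                                       ≡⟨ cong (scale *_) (total≡∑weight n m a) ⟩
      scale * ∑ (cube k n) (weight n m a)                                         ≡⟨ sym (∑-*ˡ (cube k n) scale (weight n m a)) ⟩
      ∑ (cube k n) (λ z → scale * weight n m a z)                                 ≤⟨ ∑-mono (cube k n) pointwise ⟩
      ∑ (cube k n) (λ z → high + scale * (𝟙 (unbalanced n D z) * weight n m a z)) ≡⟨ ∑-+ (cube k n) _ _ ⟩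
      ∑ (cube k n) (λ z → high) + ∑ (cube k n) (λ z → scale * (𝟙 (unbalanced n D z) * weight n m a z))
        ≡⟨ cong₂ _+_ (trans (∑-const (cube k n) high) (cong (_* high) (length-cube k n))) (∑-*ˡ (cube k n) scale _) ⟩
      k ^ n * high + scale * unbalancedWeight        ∎
      where
      open ≤-Reasoning
      pointwise : ∀ z → scale * weight n m a z ≤ high + scale * (𝟙 (unbalanced n D z) * weight n m a z)
      pointwise z with unbalanced n D z in e
      ... | true = ≤-trans (≤-reflexive (cong (scale *_) (sym (*-identityˡ (weight n m a z))))) (m≤n+m _ high)
      ... | false = ≤-trans (scale*weight≤high z e) (m≤m+n high _)

    module _ (E : ℕ) (k≥1 : 1 ≤ k) (E+km≤D : E + k * m ≤ D) where

      private
        inSlice : ∀ {t} → Vec (Fin k) t → ℕ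
        inSlice x = 𝟙 (vecEqᵇ a (typeOf x))

      unbalanced-in-subspace : ∀ (J : Subset n) → trues J ≡ m →
        ∑ (cube k (falses J)) (λ y → ∑ (cube k (trues J)) (λ x → inSlice x * (𝟙 (unbalanced n D (merge J x y)) * (E * E))))
          ≤ k * (n * k) * (k ^ falses J * sliceSize k (trues J) a)
      unbalanced-in-subspace J |J|≡m = begin
        ∑ Y (λ y → ∑ X (λ x → inSlice x * (𝟙 (unbalanced n D (merge J x y)) * (E * E))))
          ≤⟨ ∑-mono Y (λ y → ∑-mono X (λ x → *-monoʳ-≤ (inSlice x) (*-monoˡ-≤ (E * E) (unbalanced-merge m D E J x y k≥1 |J|≡m E+km≤D)))) ⟩
        ∑ Y (λ y → ∑ X (λ x → inSlice x * cheb y))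
          ≡⟨ ∑-cong Y (λ y → trans (∑-*ʳ X (cheb y) inSlice) (cong (_* cheb y) (sym (countL≡∑𝟙 _ X)))) ⟩
        ∑ Y (λ y → size * cheb y)    ≡⟨ ∑-*ˡ Y size cheb ⟩
        size * ∑ Y cheb              ≤⟨ *-monoʳ-≤ size (chebyshev k f E) ⟩
        size * (k * (f * k * k ^ f)) ≤⟨ *-monoʳ-≤ size (*-monoʳ-≤ k (*-monoˡ-≤ (k ^ f) (*-monoˡ-≤ k f≤n))) ⟩
        size * (k * (n * k * k ^ f)) ≡⟨ solve 4 (λ c k n p → c :* (k :* (n :* k :* p)) := k :* (n :* k) :* (p :* c)) refl size k n (k ^ f) ⟩
        k * (n * k) * (k ^ f * size) ∎
        where
        open ≤-Reasoning
        f = falses J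
        X = cube k (trues J)
        Y = cube k f
        size = sliceSize k (trues J) a
        cheb : Vec (Fin k) f → ℕ
        cheb y = 𝟙 (unbalanced f E y) * (E * E)
        f≤n : f ≤ n
        f≤n = ≤-trans (m≤n+m f (trues J)) (≤-reflexive (trues+falses J))

      unbalancedWeight*E²≤ : unbalancedWeight * (E * E) ≤ k * (n * k) * total k n m a
      unbalancedWeight*E²≤ = begin
        unbalancedWeight * (E * E)
          ≡⟨ sym (∑-*ʳ (cube k n) (E * E) _) ⟩
        ∑ (cube k n) (λ z → 𝟙 (unbalanced n D z) * weight n m a z * (E * E))
          ≡⟨ ∑-cong (cube k n) (λ z → trans (regroup (𝟙 (unbalanced n D z)) (weight n m a z) (E * E)) (sym (∑-*ʳ S _ _))) ⟩
        ∑ (cube k n) (λ z → ∑ S (λ J → inSlice (restrict J z) * (𝟙 (unbalanced n D z) * (E * E))))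
          ≡⟨ sym (∑-subsetsOfSize-merge n m a (λ z x → inSlice x * (𝟙 (unbalanced n D z) * (E * E)))) ⟩
        ∑ S (λ J → ∑ (cube k (falses J)) (λ y → ∑ (cube k (trues J)) (λ x → inSlice x * (𝟙 (unbalanced n D (merge J x y)) * (E * E)))))
          ≤⟨ ∑-monoᴬ S (trues-subsetsOfSize n m) unbalanced-in-subspace ⟩
        ∑ S (λ J → k * (n * k) * (k ^ falses J * sliceSize k (trues J) a))
          ≡⟨ trans (∑-*ˡ S (k * (n * k)) _) (cong (k * (n * k) *_) (sym (total≡∑k^*sliceSize n m a))) ⟩
        k * (n * k) * total k n m a ∎
        where
        open ≤-Reasoning
        S = subsetsOfSize n m
        regroup : ∀ u w c → u * w * c ≡ w * (u * c)
        regroup = solve 3 (λ u w c → u :* w :* c := w :* (u :* c)) refl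


module Arithmetic where

  open import Data.Nat as ℕ using (ℕ; suc; _+_; _*_; _≤_; _∸_)
  open import Data.Nat.Properties
  open import Data.Sum using (inj₁; inj₂)
  open import Relation.Binary.PropositionalEquality
  open import Data.Nat.Solver using (module +-*-Solver)
  open +-*-Solver using (solve; _:+_; _:*_; con; _:=_)

  *-self-cancel-≤ : ∀ x y → x * x ≤ y * y → x ≤ y
  *-self-cancel-≤ x y x²≤y² = ≮⇒≥ (λ y<x → <⇒≱ (*-mono-< y<x y<x) x²≤y²)

  x≤x*y : ∀ x {y} → 1 ≤ y → x ≤ x * y
  x≤x*y x {y} y≥1 = m≤m*n x y {{ℕ.>-nonZero y≥1}}

  square-chain : ∀ M′ X Y Z U → M′ * X ≤ suc M′ * Y * Z → M′ * Z ≤ suc M′ * U → M′ * M′ * X ≤ suc M′ * suc M′ * Y * U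
  square-chain M′ X Y Z U h₁ h₂ = begin
    M′ * M′ * X      ≡⟨ *-assoc M′ M′ X ⟩
    M′ * (M′ * X)    ≤⟨ *-monoʳ-≤ M′ h₁ ⟩
    M′ * (M * Y * Z) ≡⟨ solve 4 (λ a b c d → a :* (b :* c :* d) := b :* c :* (a :* d)) refl M′ M Y Z ⟩
    M * Y * (M′ * Z) ≤⟨ *-monoʳ-≤ (M * Y) h₂ ⟩
    M * Y * (M * U)  ≡⟨ solve 3 (λ m y u → m :* y :* (m :* u) := m :* m :* y :* u) refl M Y U ⟩
    M * M * Y * U    ∎
    where
    open ≤-Reasoning
    M = suc M′

  module _ (N₀ : ℕ) where

    private
      N = suc N₀
      M′ = 7 + 8 * N₀
      M = suc M′

    excess-bound : ∀ K A B d → K + d ≡ N * A → A ≤ K → M * B ≤ K → M * M * d + M′ * M′ * N * B ≤ M′ * M′ * N * A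
    excess-bound K A B d K+d≡NA A≤K MB≤K = begin
      M * M * d + M′ * M′ * N * B                        ≡⟨ solve 3 (λ m d r → (con 1 :+ m) :* (con 1 :+ m) :* d :+ r := m :* m :* d :+ ((con 2 :* m :+ con 1) :* d :+ r)) refl M′ d (M′ * M′ * N * B) ⟩
      M′ * M′ * d + ((2 * M′ + 1) * d + M′ * M′ * N * B) ≤⟨ +-monoʳ-≤ (M′ * M′ * d) cross-terms ⟩
      M′ * M′ * d + M′ * M′ * K                          ≡⟨ solve 3 (λ m d k → m :* m :* d :+ m :* m :* k := m :* m :* (k :+ d)) refl M′ d K ⟩
      M′ * M′ * (K + d)                                  ≡⟨ cong (M′ * M′ *_) K+d≡NA ⟩
      M′ * M′ * (N * A)                                  ≡⟨ sym (*-assoc (M′ * M′) N A) ⟩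
      M′ * M′ * N * A                                    ∎
      where
      open ≤-Reasoning
      d≤NK : d ≤ N * K
      d≤NK = ≤-trans (m≤n+m d K) (≤-trans (≤-reflexive K+d≡NA) (*-monoʳ-≤ N A≤K))
      M′²NB≤M′NK : M′ * M′ * N * B ≤ M′ * N * K
      M′²NB≤M′NK = begin
        M′ * M′ * N * B   ≡⟨ solve 3 (λ m n b → m :* m :* n :* b := m :* n :* (m :* b)) refl M′ N B ⟩
        M′ * N * (M′ * B) ≤⟨ *-monoʳ-≤ (M′ * N) (≤-trans (*-monoˡ-≤ B (n≤1+n M′)) MB≤K) ⟩
        M′ * N * K        ∎
      cross-terms : (2 * M′ + 1) * d + M′ * M′ * N * B ≤ M′ * M′ * K
      cross-terms = begin
        (2 * M′ + 1) * d + M′ * M′ * N * B                     ≤⟨ +-mono-≤ (*-monoʳ-≤ (2 * M′ + 1) d≤NK) M′²NB≤M′NK ⟩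
        (2 * M′ + 1) * (N * K) + M′ * N * K                    ≡⟨ solve 3 (λ m n k → (con 2 :* m :+ con 1) :* (n :* k) :+ m :* n :* k := (con 3 :* m :+ con 1) :* n :* k) refl M′ N K ⟩
        (3 * M′ + 1) * N * K                                   ≤⟨ *-monoˡ-≤ K (m≤m+n ((3 * M′ + 1) * N) (27 + 66 * N₀ + 40 * N₀ * N₀)) ⟩
        ((3 * M′ + 1) * N + (27 + 66 * N₀ + 40 * N₀ * N₀)) * K ≡⟨ cong (_* K) (solve 1 (λ x → (con 3 :* (con 7 :+ con 8 :* x) :+ con 1) :* (con 1 :+ x) :+ (con 27 :+ con 66 :* x :+ con 40 :* x :* x) := (con 7 :+ con 8 :* x) :* (con 7 :+ con 8 :* x)) refl N₀) ⟩
        M′ * M′ * K                                            ∎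

    -- A ≤ W / Lo + B,  T ≤ K Hi / (1 - 1/M),  Hi ≤ Lo / (1 - 1/M),  B ≤ K / M   ⟹   A / K ≤ W / T + 1 / N
    density-inequality : ∀ K A T W Lo Hi B →
      A ≤ K → 8 * N * T ≤ 8 * N * K * Hi + T → 8 * N * Hi ≤ 8 * N * Lo + Hi → 8 * N * B ≤ K → Lo * A ≤ W + Lo * B →
      N * A * T ≤ N * K * W + K * T
    density-inequality K A T W Lo Hi B A≤K T≤ Hi≤ 8NB≤K LoA≤ with ≤-total (N * A) K
    ... | inj₁ NA≤K = ≤-trans (*-monoˡ-≤ T NA≤K) (m≤n+m (K * T) _)
    ... | inj₂ K≤NA = begin
      N * A * T         ≡⟨ cong (_* T) (sym K+d≡NA) ⟩
      (K + d) * T       ≡⟨ solve 3 (λ k d t → (k :+ d) :* t := d :* t :+ k :* t) refl K d T ⟩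
      d * T + K * T     ≤⟨ +-monoˡ-≤ (K * T) (≤-trans (≤-reflexive (*-comm d T)) Td≤NKW) ⟩
      N * K * W + K * T ∎
      where
      open ≤-Reasoning
      8N≡M : 8 * N ≡ M
      8N≡M = solve 1 (λ x → con 8 :* (con 1 :+ x) := con 8 :+ con 8 :* x) refl N₀
      MB≤K : M * B ≤ K
      MB≤K = subst (λ c → c * B ≤ K) 8N≡M 8NB≤K
      d = N * A ∸ K
      K+d≡NA : K + d ≡ N * A
      K+d≡NA = m+[n∸m]≡n K≤NA
      M′²T≤M²KLo : M′ * M′ * T ≤ M * M * K * Lo
      M′²T≤M²KLo = square-chain M′ T K Hi Lo
        (+-cancelˡ-≤ T _ _ (≤-trans (subst (λ c → c * T ≤ c * K * Hi + T) 8N≡M T≤) (≤-reflexive (+-comm _ T))))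
        (+-cancelˡ-≤ Hi _ _ (≤-trans (subst (λ c → c * Hi ≤ c * Lo + Hi) 8N≡M Hi≤) (≤-reflexive (+-comm _ Hi))))
      M²Lod≤M′²NW : M * M * Lo * d ≤ M′ * M′ * N * W
      M²Lod≤M′²NW = +-cancelʳ-≤ (M′ * M′ * N * (Lo * B)) _ _ (begin
        M * M * Lo * d + M′ * M′ * N * (Lo * B)  ≡⟨ solve 6 (λ a b l d n c → a :* l :* d :+ b :* n :* (l :* c) := l :* (a :* d :+ b :* n :* c)) refl (M * M) (M′ * M′) Lo d N B ⟩
        Lo * (M * M * d + M′ * M′ * N * B)       ≤⟨ *-monoʳ-≤ Lo (excess-bound K A B d K+d≡NA A≤K MB≤K) ⟩
        Lo * (M′ * M′ * N * A)                   ≡⟨ solve 3 (λ l r a → l :* (r :* a) := r :* (l :* a)) refl Lo (M′ * M′ * N) A ⟩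
        M′ * M′ * N * (Lo * A)                   ≤⟨ *-monoʳ-≤ (M′ * M′ * N) LoA≤ ⟩
        M′ * M′ * N * (W + Lo * B)               ≡⟨ *-distribˡ-+ (M′ * M′ * N) W (Lo * B) ⟩
        M′ * M′ * N * W + M′ * M′ * N * (Lo * B) ∎)
      Td≤NKW : T * d ≤ N * K * W
      Td≤NKW = *-cancelˡ-≤ (M′ * M′) (begin
        M′ * M′ * (T * d)     ≡⟨ sym (*-assoc (M′ * M′) T d) ⟩
        M′ * M′ * T * d       ≤⟨ *-monoˡ-≤ d M′²T≤M²KLo ⟩
        M * M * K * Lo * d    ≡⟨ solve 4 (λ a k l d → a :* k :* l :* d := k :* (a :* l :* d)) refl (M * M) K Lo d ⟩
        K * (M * M * Lo * d)  ≤⟨ *-monoʳ-≤ K M²Lod≤M′²NW ⟩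
        K * (M′ * M′ * N * W) ≡⟨ solve 4 (λ k r n w → k :* (r :* n :* w) := r :* (n :* k :* w)) refl K (M′ * M′) N W ⟩
        M′ * M′ * (N * K * W) ∎)


module Parameters where

  open import Data.Nat as ℕ using (ℕ; suc; _+_; _*_; _^_; _≤_; _<_; _∸_; z≤n; s≤s; _/_; _%_)
  open import Data.Nat.Properties
  open import Data.Nat.DivMod using (m/n*n≤m; m≡m%n+[m/n]*n; m%n<n)
  open import Relation.Binary.PropositionalEquality
  open import Data.Nat.Solver using (module +-*-Solver)
  open +-*-Solver using (solve; _:+_; _:*_; con; _:=_)
  open Arithmetic using (*-self-cancel-≤; x≤x*y)

  -- N ≥ 1/η; a point z is balanced when |k·cⱼ(z) - n| < D for every letter j, and the smaller radius
  -- E = D - k m is what survives after fixing the m coordinates of a subspace.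
  module Constants (N₀ k m₀ n : ℕ) (k≥1 : 1 ≤ k) (m⁴≤n : suc m₀ ^ 4 ≤ n) (G¹²≤n : (8 * k * suc N₀) ^ 12 ≤ n) where

    N m M G R D E : ℕ
    N = suc N₀
    m = suc m₀
    M = 8 * N
    G = 8 * k * N
    R = 32 * m * N
    D = n / R
    E = D ∸ k * m

    G⁶m²≤n : G ^ 6 * (m * m) ≤ n
    G⁶m²≤n = *-self-cancel-≤ _ _ (begin
      G ^ 6 * (m * m) * (G ^ 6 * (m * m)) ≡⟨ solve 2 (λ g m → g :* (m :* m) :* (g :* (m :* m)) := g :* g :* (m :* (m :* (m :* (m :* con 1))))) refl (G ^ 6) m ⟩
      G ^ 6 * G ^ 6 * m ^ 4               ≡⟨ cong (_* m ^ 4) (sym (^-distribˡ-+-* G 6 6)) ⟩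
      G ^ 12 * m ^ 4                      ≤⟨ *-mono-≤ G¹²≤n m⁴≤n ⟩
      n * n                               ∎)
      where open ≤-Reasoning

    32Nk²R²≤n : 32 * N * (k * k) * (R * R) ≤ n
    32Nk²R²≤n = ≤-trans (begin
      32 * N * (k * k) * (R * R)                     ≡⟨ solve 3 (λ n k m → con 32 :* n :* (k :* k) :* ((con 32 :* m :* n) :* (con 32 :* m :* n))
                                                        := (con 8 :* n) :* (con 8 :* n) :* (con 8 :* n) :* (con 8 :* k) :* (con 8 :* k) :* (m :* m)) refl N k m ⟩
      8 * N * (8 * N) * (8 * N) * (8 * k) * (8 * k) * (m * m) ≤⟨ *-monoˡ-≤ (m * m) (*-mono-≤ (*-mono-≤ (*-mono-≤ (*-mono-≤ 8N≤G 8N≤G) 8N≤G) 8k≤G) 8k≤G) ⟩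
      G * G * G * G * G * (m * m)                             ≤⟨ *-monoˡ-≤ (m * m) (x≤x*y (G * G * G * G * G) G≥1) ⟩
      G * G * G * G * G * G * (m * m)                         ≡⟨ cong (_* (m * m)) (solve 1 (λ g → g :* g :* g :* g :* g :* g := g :* (g :* (g :* (g :* (g :* (g :* con 1)))))) refl G) ⟩
      G ^ 6 * (m * m)                                ∎) G⁶m²≤n
      where
      open ≤-Reasoning
      8k≤G : 8 * k ≤ G
      8k≤G = x≤x*y (8 * k) (s≤s z≤n)
      8N≤G : 8 * N ≤ G
      8N≤G = ≤-trans (≤-trans (m≤n*m (8 * N) k {{ℕ.>-nonZero k≥1}}) (≤-reflexive (*-comm k (8 * N)))) (≤-reflexive (solve 2 (λ k n → con 8 :* n :* k := con 8 :* k :* n) refl k N))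
      G≥1 : 1 ≤ G
      G≥1 = ≤-trans k≥1 (≤-trans (x≤x*y k (s≤s z≤n)) (≤-trans (m≤n*m (k * N) 8) (≤-reflexive (sym (*-assoc 8 k N)))))

    private
      km≥1 : 1 ≤ k * m
      km≥1 = *-mono-≤ k≥1 (s≤s z≤n)

      128kNm²≤n : 128 * k * N * (m * m) ≤ n
      128kNm²≤n = ≤-trans (≤-trans (x≤x*y (128 * k * N * (m * m)) (*-mono-≤ (*-mono-≤ (*-mono-≤ (≤ᵇ⇒≤ 1 256 _) (s≤s (z≤n {N₀}))) (s≤s (z≤n {N₀}))) k≥1))
        (≤-reflexive (solve 3 (λ n k m → con 128 :* k :* n :* (m :* m) :* (con 256 :* n :* n :* k)
                                      := con 32 :* n :* (k :* k) :* ((con 32 :* m :* n) :* (con 32 :* m :* n))) refl N k m))) 32Nk²R²≤n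

      2R[1+km]≤n : 2 * R * (1 + k * m) ≤ n
      2R[1+km]≤n = ≤-trans (*-monoʳ-≤ (2 * R) (+-monoˡ-≤ (k * m) km≥1))
        (≤-trans (≤-reflexive (solve 3 (λ n k m → con 2 :* (con 32 :* m :* n) :* (k :* m :+ k :* m) := con 128 :* k :* n :* (m :* m)) refl N k m)) 128kNm²≤n)

      16Nkm²≤n : 16 * N * k * (m * m) ≤ n
      16Nkm²≤n = ≤-trans (≤-trans (≤-reflexive (solve 3 (λ n k m → con 16 :* n :* k :* (m :* m) := con 16 :* (k :* n :* (m :* m))) refl N k m))
                                   (*-monoˡ-≤ (k * N * (m * m)) (≤ᵇ⇒≤ 16 128 _)))
                          (≤-trans (≤-reflexive (solve 3 (λ n k m → con 128 :* (k :* n :* (m :* m)) := con 128 :* k :* n :* (m :* m)) refl N k m)) 128kNm²≤n)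

      D*R≤n : D * R ≤ n
      D*R≤n = m/n*n≤m n R

      n<R+D*R : n < R + D * R
      n<R+D*R = begin-strict
        n             ≡⟨ m≡m%n+[m/n]*n n R ⟩
        n % R + D * R <⟨ +-monoˡ-< (D * R) (m%n<n n R) ⟩
        R + D * R     ∎
        where open ≤-Reasoning

      2≤R : 2 ≤ R
      2≤R = ≤-trans (≤ᵇ⇒≤ 2 32 _) (≤-trans (x≤x*y 32 (s≤s z≤n)) (x≤x*y (32 * m) (s≤s z≤n)))

      2[1+km]≤D : 2 * (1 + k * m) ≤ D
      2[1+km]≤D = ℕ.s≤s⁻¹ (*-cancelʳ-< R _ _ (begin-strict
        2 * (1 + k * m) * R ≡⟨ solve 2 (λ x r → con 2 :* (con 1 :+ x) :* r := con 2 :* r :* (con 1 :+ x)) refl (k * m) R ⟩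
        2 * R * (1 + k * m) ≤⟨ 2R[1+km]≤n ⟩
        n                   <⟨ n<R+D*R ⟩
        R + D * R           ≡⟨ solve 2 (λ r d → r :+ d :* r := (con 1 :+ d) :* r) refl R D ⟩
        (1 + D) * R         ∎))
        where open ≤-Reasoning

      1+km≤D : 1 + k * m ≤ D
      1+km≤D = ≤-trans (m≤m+n (1 + k * m) _) (≤-trans (≤-reflexive (cong ((1 + k * m) +_) (sym (+-identityʳ _)))) 2[1+km]≤D)

    E+km≡D : E + k * m ≡ D
    E+km≡D = m∸n+n≡m (≤-trans (n≤1+n (k * m)) 1+km≤D)

    E≥1 : 1 ≤ E
    E≥1 = +-cancelʳ-≤ (k * m) 1 E (≤-trans 1+km≤D (≤-reflexive (sym E+km≡D)))

    private
      n≤2RE : n ≤ 2 * R * E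
      n≤2RE = <⇒≤ (+-cancelʳ-< _ n (2 * R * E) (+-cancelˡ-< (2 * R) _ _ (begin-strict
        2 * R + (n + 2 * R * (k * m))         ≡⟨ solve 3 (λ r n x → con 2 :* r :+ (n :+ con 2 :* r :* x) := n :+ con 2 :* r :* (con 1 :+ x)) refl R n (k * m) ⟩
        n + 2 * R * (1 + k * m)               ≤⟨ +-monoʳ-≤ n 2R[1+km]≤n ⟩
        n + n                                 ≡⟨ solve 1 (λ n → n :+ n := con 2 :* n) refl n ⟩
        2 * n                                 <⟨ *-monoʳ-< 2 n<R+D*R ⟩
        2 * (R + D * R)                       ≡⟨ cong (λ t → 2 * (R + t * R)) (sym E+km≡D) ⟩
        2 * (R + (E + k * m) * R)             ≡⟨ solve 3 (λ r x e → con 2 :* (r :+ (e :+ x) :* r) := con 2 :* r :+ (con 2 :* r :* e :+ con 2 :* r :* x)) refl R (k * m) E ⟩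
        2 * R + (2 * R * E + 2 * R * (k * m)) ∎)))
        where open ≤-Reasoning

    M*k*nk≤E² : M * (k * (n * k)) ≤ E * E
    M*k*nk≤E² = *-cancelˡ-≤ (4 * (R * R)) (begin
      4 * (R * R) * (M * (k * (n * k))) ≡⟨ solve 4 (λ r n k x → con 4 :* (r :* r) :* ((con 8 :* n) :* (k :* (x :* k))) := con 32 :* n :* (k :* k) :* (r :* r) :* x) refl R N k n ⟩
      32 * N * (k * k) * (R * R) * n    ≤⟨ *-monoˡ-≤ n 32Nk²R²≤n ⟩
      n * n                             ≤⟨ *-mono-≤ n≤2RE n≤2RE ⟩
      2 * R * E * (2 * R * E)           ≡⟨ solve 2 (λ r e → con 2 :* r :* e :* (con 2 :* r :* e) := con 4 :* (r :* r) :* (e :* e)) refl R E ⟩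
      4 * (R * R) * (E * E)             ∎)
      where open ≤-Reasoning

    M*m*[2D+km]≤n : M * (m * (2 * D + k * m)) ≤ n
    M*m*[2D+km]≤n = *-cancelˡ-≤ 2 (begin
      2 * (M * (m * (2 * D + k * m))) ≡⟨ solve 4 (λ n m d x → con 2 :* ((con 8 :* n) :* (m :* (con 2 :* d :+ x))) := d :* (con 32 :* m :* n) :+ con 16 :* n :* m :* x) refl N m D (k * m) ⟩
      D * R + 16 * N * m * (k * m)    ≡⟨ cong (D * R +_) (solve 3 (λ n m k → con 16 :* n :* m :* (k :* m) := con 16 :* n :* k :* (m :* m)) refl N m k) ⟩
      D * R + 16 * N * k * (m * m)    ≤⟨ +-mono-≤ D*R≤n 16Nkm²≤n ⟩
      n + n                           ≡⟨ solve 1 (λ n → n :+ n := con 2 :* n) refl n ⟩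
      2 * n                           ∎)
      where open ≤-Reasoning

    D+km<n : D + k * m < n
    D+km<n = *-cancelˡ-≤ 2 (begin
      2 * suc (D + k * m)     ≡⟨ solve 2 (λ d x → con 2 :* (con 1 :+ (d :+ x)) := d :* con 2 :+ con 2 :* (con 1 :+ x)) refl D (k * m) ⟩
      D * 2 + 2 * (1 + k * m) ≤⟨ +-mono-≤ (≤-trans (*-monoʳ-≤ D 2≤R) D*R≤n) (≤-trans (*-monoˡ-≤ (1 + k * m) (x≤x*y 2 (≤-trans (s≤s z≤n) 2≤R))) 2R[1+km]≤n) ⟩
      n + n                   ≡⟨ solve 1 (λ n → n :+ n := con 2 :* n) refl n ⟩
      2 * n                   ∎)
      where open ≤-Reasoning


module SliceBound where

  open import Data.Nat as ℕ using (ℕ; zero; suc; _+_; _*_; _^_; _≤_; _<_; _∸_; z≤n; s≤s)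
  open import Data.Nat.Properties
  open import Data.Bool using (Bool; true)
  open import Data.Fin using (Fin)
  open import Data.Vec as Vec using (Vec)
  open import Data.List.Properties using (length-filter)
  open import Relation.Nullary.Decidable using (T?)
  open import Function using (_∘_)
  open import Relation.Binary.PropositionalEquality
  open import Data.Nat.Solver using (module +-*-Solver)
  open +-*-Solver using (solve; _:+_; _:*_; con; _:=_)
  open import Defs
  open FiniteSums
  open Words
  open TypeCounts
  open FallingBounds
  open Concentration
  open DoubleCounting
  open WeightBounds
  open Arithmetic
  open Parameters

  module _ (N₀ k m₀ n : ℕ) (A : Vec (Fin k) n → Bool) (a : Vec ℕ k) (∑a≡m : ∑ᶠ (Vec.lookup a) ≡ suc m₀)
           (k≥1 : 1 ≤ k) (m⁴≤n : suc m₀ ^ 4 ≤ n) (G¹²≤n : (8 * k * suc N₀) ^ 12 ≤ n) where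

    open Constants N₀ k m₀ n k≥1 m⁴≤n G¹²≤n
    open Weights n a ∑a≡m D

    private
      K = k ^ n
      total′ = total k n m a

      K≥1 : 1 ≤ K
      K≥1 = m^n>0 k {{ℕ.>-nonZero k≥1}} n

      scale≥1 : 1 ≤ scale
      scale≥1 = *-mono-≤ (m^n>0 k {{ℕ.>-nonZero k≥1}} m) (≤-trans (≤-reflexive (sym (∏ᶠ-1 k))) (∏ᶠ-mono (λ j → 1≤n! (Vec.lookup a j))))
        where
        ∏ᶠ-1 : ∀ k → ∏ᶠ {k} (λ _ → 1) ≡ 1
        ∏ᶠ-1 zero = refl
        ∏ᶠ-1 (suc k) = trans (+-identityʳ _) (∏ᶠ-1 k)

      low≥1 : 1 ≤ low
      low≥1 = m^n>0 (n ∸ (D + k * m)) {{ℕ.>-nonZero (m<n⇒0<n∸m D+km<n)}} m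

      -- Bernoulli: (x + y)^m ≤ x^m + m y (x + y)^(m-1) with x = n - (D + k m), x + y = n + D
      n*high≤ : n * high ≤ n * low + m * (2 * D + k * m) * high
      n*high≤ = begin
        n * high                             ≤⟨ *-monoʳ-≤ n (≤-trans (≤-reflexive (cong (_^ m) (sym x+y≡n+D))) (+-^-upper m₀ x y)) ⟩
        n * (x ^ m + m * y * (x + y) ^ m₀)   ≡⟨ cong (λ t → n * (x ^ m + m * y * t ^ m₀)) x+y≡n+D ⟩
        n * (low + m * y * (n + D) ^ m₀)     ≡⟨ solve 4 (λ n l c p → n :* (l :+ c :* p) := n :* l :+ c :* (n :* p)) refl n low (m * y) ((n + D) ^ m₀) ⟩
        n * low + m * y * (n * (n + D) ^ m₀) ≤⟨ +-monoʳ-≤ (n * low) (*-monoʳ-≤ (m * y) (*-monoˡ-≤ ((n + D) ^ m₀) (m≤m+n n D))) ⟩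
        n * low + m * y * high               ∎
        where
        open ≤-Reasoning
        x = n ∸ (D + k * m)
        y = 2 * D + k * m
        x+y≡n+D : x + y ≡ n + D
        x+y≡n+D = trans (solve 3 (λ x d u → x :+ (con 2 :* d :+ u) := (x :+ (d :+ u)) :+ d) refl x D (k * m)) (cong (_+ D) (m∸n+n≡m (<⇒≤ D+km<n)))

      M*high≤ : M * high ≤ M * low + high
      M*high≤ = *-cancelˡ-≤ n {{ℕ.>-nonZero (≤-trans (s≤s z≤n) D+km<n)}} (begin
        n * (M * high)                     ≡⟨ solve 3 (λ n m h → n :* (m :* h) := m :* (n :* h)) refl n M high ⟩
        M * (n * high)                     ≤⟨ *-monoʳ-≤ M n*high≤ ⟩
        M * (n * low + m * y * high)       ≡⟨ solve 5 (λ M n l my h → M :* (n :* l :+ my :* h) := n :* (M :* l) :+ M :* my :* h) refl M n low (m * y) high ⟩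
        n * (M * low) + M * (m * y) * high ≤⟨ +-monoʳ-≤ (n * (M * low)) (*-monoˡ-≤ high M*m*[2D+km]≤n) ⟩
        n * (M * low) + n * high           ≡⟨ sym (*-distribˡ-+ n (M * low) high) ⟩
        n * (M * low + high)               ∎)
        where
        open ≤-Reasoning
        y = 2 * D + k * m

      M*scale*total≤ : M * (scale * total′) ≤ M * K * high + scale * total′
      M*scale*total≤ = *-cancelˡ-≤ (E * E) {{ℕ.>-nonZero (*-mono-≤ E≥1 E≥1)}} (begin
        E * E * (M * (scale * total′))                                ≡⟨ solve 4 (λ e m v t → e :* (m :* (v :* t)) := m :* e :* (v :* t)) refl (E * E) M scale total′ ⟩
        M * (E * E) * (scale * total′)                                ≤⟨ *-monoʳ-≤ (M * (E * E)) scale*total≤ ⟩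
        M * (E * E) * (K * high + scale * X)                          ≡⟨ solve 6 (λ m e k h v x → m :* e :* (k :* h :+ v :* x) := e :* (m :* k :* h) :+ m :* v :* (x :* e)) refl M (E * E) K high scale X ⟩
        E * E * (M * K * high) + M * scale * (X * (E * E))            ≤⟨ +-monoʳ-≤ (E * E * (M * K * high)) (*-monoʳ-≤ (M * scale) (unbalancedWeight*E²≤ E k≥1 (≤-reflexive E+km≡D))) ⟩
        E * E * (M * K * high) + M * scale * (k * (n * k) * total′)   ≡⟨ cong (E * E * (M * K * high) +_) (solve 5 (λ m v k n t → m :* v :* (k :* (n :* k) :* t) := m :* (k :* (n :* k)) :* (v :* t)) refl M scale k n total′) ⟩
        E * E * (M * K * high) + M * (k * (n * k)) * (scale * total′) ≤⟨ +-monoʳ-≤ (E * E * (M * K * high)) (*-monoˡ-≤ (scale * total′) M*k*nk≤E²) ⟩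
        E * E * (M * K * high) + E * E * (scale * total′)             ≡⟨ sym (*-distribˡ-+ (E * E) _ _) ⟩
        E * E * (M * K * high + scale * total′)                       ∎)
        where
        open ≤-Reasoning
        X = unbalancedWeight

      M*#unbalanced≤K : M * #unbalanced ≤ K
      M*#unbalanced≤K = *-cancelˡ-≤ (D * D) {{ℕ.>-nonZero (*-mono-≤ D≥1 D≥1)}} (begin
        D * D * (M * #unbalanced)                               ≡⟨ solve 3 (λ d m b → d :* (m :* b) := m :* (b :* d)) refl (D * D) M #unbalanced ⟩
        M * (#unbalanced * (D * D))                             ≡⟨ cong (M *_) (sym (∑-*ʳ (cube k n) (D * D) _)) ⟩
        M * ∑ (cube k n) (λ z → 𝟙 (unbalanced n D z) * (D * D)) ≤⟨ *-monoʳ-≤ M (chebyshev k n D) ⟩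
        M * (k * (n * k * K))                                   ≡⟨ solve 4 (λ m k n K → m :* (k :* (n :* k :* K)) := m :* (k :* (n :* k)) :* K) refl M k n K ⟩
        M * (k * (n * k)) * K                                   ≤⟨ *-monoˡ-≤ K (≤-trans M*k*nk≤E² (*-mono-≤ E≤D E≤D)) ⟩
        D * D * K                                               ∎)
        where
        open ≤-Reasoning
        E≤D : E ≤ D
        E≤D = ≤-trans (m≤m+n E (k * m)) (≤-reflexive E+km≡D)
        D≥1 : 1 ≤ D
        D≥1 = ≤-trans E≥1 E≤D

      #unbalanced<K : #unbalanced < K
      #unbalanced<K with #unbalanced in e
      ... | zero = K≥1
      ... | suc b = begin
        suc (suc b)     ≤⟨ s≤s (m≤n+m (suc b) b) ⟩
        suc b + suc b   ≡⟨ cong (suc b +_) (sym (+-identityʳ (suc b))) ⟩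
        2 * suc b       ≤⟨ *-monoˡ-≤ (suc b) (≤-trans (≤ᵇ⇒≤ 2 8 _) (*-monoʳ-≤ 8 (s≤s (z≤n {N₀})))) ⟩
        M * suc b       ≡⟨ cong (M *_) (sym e) ⟩
        M * #unbalanced ≤⟨ M*#unbalanced≤K ⟩
        K               ∎
        where open ≤-Reasoning

    N*#A*total≤ : suc N₀ * countL A (cube k n) * total k n m a ≤ suc N₀ * k ^ n * hits k n m A a + k ^ n * total k n m a
    N*#A*total≤ = *-cancelˡ-≤ scale {{ℕ.>-nonZero scale≥1}} (begin
      scale * (N * #A * total′) ≡⟨ solve 4 (λ v n a t → v :* (n :* a :* t) := n :* a :* (v :* t)) refl scale N #A total′ ⟩
      N * #A * (scale * total′) ≤⟨ density-inequality N₀ K #A (scale * total′) (scale * hits k n m A a) low high #unbalanced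
                                                        #A≤K M*scale*total≤ M*high≤ M*#unbalanced≤K (low*#A≤ A) ⟩
      N * K * (scale * hits k n m A a) + K * (scale * total′)
                                                   ≡⟨ solve 5 (λ v n k w t → n :* k :* (v :* w) :+ k :* (v :* t) := v :* (n :* k :* w :+ k :* t)) refl scale N K (hits k n m A a) total′ ⟩
      scale * (N * K * hits k n m A a + K * total′) ∎)
      where
      open ≤-Reasoning
      #A = countL A (cube k n)
      #A≤K : #A ≤ K
      #A≤K = ≤-trans (length-filter (T? ∘ A) (cube k n)) (≤-reflexive (length-cube k n))

    -- low·kⁿ ≤ scale·total + low·#unbalanced is the case A = [k]ⁿ of low*#A≤, and #unbalanced < kⁿ
    total≥1 : 1 ≤ total k n m a
    total≥1 = n≢0⇒n>0 λ total≡0 → <⇒≱ #unbalanced<K (*-cancelˡ-≤ low {{ℕ.>-nonZero low≥1}} (begin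
      low * K                              ≡⟨ cong (low *_) (sym (trans (countL≡∑𝟙 _ (cube k n)) (trans (sym (length≡∑1 (cube k n))) (length-cube k n)))) ⟩
      low * countL (λ _ → true) (cube k n) ≤⟨ low*#A≤ (λ _ → true) ⟩
      scale * total′ + low * #unbalanced   ≡⟨ cong (λ t → scale * t + low * #unbalanced) total≡0 ⟩
      scale * 0 + low * #unbalanced        ≡⟨ cong (_+ low * #unbalanced) (*-zeroʳ scale) ⟩
      low * #unbalanced                    ∎))
      where open ≤-Reasoning


module Fractions where

  open import Data.Nat as ℕ using (ℕ; zero; suc; z≤n)
  import Data.Nat.Properties as ℕP
  open import Data.Integer as ℤ using (+_)
  import Data.Integer.Properties as ℤP
  open import Data.Rational using (0ℚ; _+_; _*_; _≤_; _<_; toℚᵘ)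
  import Data.Rational.Properties as ℚP
  open import Data.Rational.Unnormalised as ℚᵘ using (mkℚᵘ) renaming (_≃_ to _≃ᵘ_; _≤_ to _≤ᵘ_)
  import Data.Rational.Unnormalised.Properties as ℚᵘP
  open import Relation.Binary.PropositionalEquality
  open import Data.Nat.Solver using (module +-*-Solver)
  open +-*-Solver using (solve; _:+_; _:*_; con; _:=_)
  open import Defs using (frac)

  toℚᵘ-frac : ∀ a b → toℚᵘ (frac a (suc b)) ≃ᵘ mkℚᵘ (+ a) b
  toℚᵘ-frac a b = ℚP.toℚᵘ-fromℚᵘ (mkℚᵘ (+ a) b)

  frac-≤ : ∀ a b c d → a ℕ.* suc d ℕ.≤ c ℕ.* suc b → frac a (suc b) ≤ frac c (suc d)
  frac-≤ a b c d h = ℚP.toℚᵘ-cancel-≤ (ℚᵘP.≤-respʳ-≃ (ℚᵘP.≃-sym (toℚᵘ-frac c d)) (ℚᵘP.≤-respˡ-≃ (ℚᵘP.≃-sym (toℚᵘ-frac a b))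
    (ℚᵘ.*≤* (subst₂ ℤ._≤_ (ℤP.pos-* a (suc d)) (ℤP.pos-* c (suc b)) (ℤ.+≤+ h)))))

  frac-< : ∀ a b c d → a ℕ.* suc d ℕ.< c ℕ.* suc b → frac a (suc b) < frac c (suc d)
  frac-< a b c d h = ℚP.toℚᵘ-cancel-< (ℚᵘP.<-respʳ-≃ (ℚᵘP.≃-sym (toℚᵘ-frac c d)) (ℚᵘP.<-respˡ-≃ (ℚᵘP.≃-sym (toℚᵘ-frac a b))
    (ℚᵘ.*<* (subst₂ ℤ._<_ (ℤP.pos-* a (suc d)) (ℤP.pos-* c (suc b)) (ℤ.+<+ h)))))

  frac-≤⁻¹ : ∀ a b c d → frac a (suc b) ≤ frac c (suc d) → a ℕ.* suc d ℕ.≤ c ℕ.* suc b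
  frac-≤⁻¹ a b c d h with ℚᵘP.≤-respʳ-≃ (toℚᵘ-frac c d) (ℚᵘP.≤-respˡ-≃ (toℚᵘ-frac a b) (ℚP.toℚᵘ-mono-≤ h))
  ... | ℚᵘ.*≤* le with subst₂ ℤ._≤_ (sym (ℤP.pos-* a (suc d))) (sym (ℤP.pos-* c (suc b))) le
  ...   | ℤ.+≤+ ad≤cb = ad≤cb

  frac-≡ : ∀ a b c d → a ℕ.* suc d ≡ c ℕ.* suc b → frac a (suc b) ≡ frac c (suc d)
  frac-≡ a b c d h = ℚP.toℚᵘ-injective (ℚᵘP.≃-trans (toℚᵘ-frac a b) (ℚᵘP.≃-trans
    (ℚᵘ.*≡* (trans (sym (ℤP.pos-* a (suc d))) (trans (cong +_ h) (ℤP.pos-* c (suc b))))) (ℚᵘP.≃-sym (toℚᵘ-frac c d))))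

  frac-+ : ∀ a b c d → frac a (suc b) + frac c (suc d) ≡ frac (a ℕ.* suc d ℕ.+ c ℕ.* suc b) (suc b ℕ.* suc d)
  frac-+ a b c d = ℚP.toℚᵘ-injective (ℚᵘP.≃-trans (ℚP.toℚᵘ-homo-+ (frac a (suc b)) (frac c (suc d)))
    (ℚᵘP.≃-trans (ℚᵘP.+-cong (toℚᵘ-frac a b) (toℚᵘ-frac c d)) (ℚᵘP.≃-trans (ℚᵘP.≃-reflexive numerator) (ℚᵘP.≃-sym (toℚᵘ-frac _ _)))))
    where
    numerator : mkℚᵘ (+ a) b ℚᵘ.+ mkℚᵘ (+ c) d ≡ mkℚᵘ (+ (a ℕ.* suc d ℕ.+ c ℕ.* suc b)) (ℕ.pred (suc b ℕ.* suc d))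
    numerator = cong (λ t → mkℚᵘ t (ℕ.pred (suc b ℕ.* suc d)))
      (trans (cong₂ ℤ._+_ (sym (ℤP.pos-* a (suc d))) (sym (ℤP.pos-* c (suc b)))) (sym (ℤP.pos-+ (a ℕ.* suc d) (c ℕ.* suc b))))

  frac-0 : ∀ b → frac 0 b ≡ 0ℚ
  frac-0 zero = refl
  frac-0 (suc b) = frac-≡ 0 b 0 0 refl

  0≤frac : ∀ a b → 0ℚ ≤ frac a b
  0≤frac a zero = ℚP.≤-refl
  0≤frac a (suc b) = subst (_≤ frac a (suc b)) (frac-0 1) (frac-≤ 0 0 a b z≤n)

  frac-+-same : ∀ a c d → frac a d + frac c d ≡ frac (a ℕ.+ c) d
  frac-+-same a c zero = ℚP.+-identityʳ 0ℚ
  frac-+-same a c (suc d) = trans (frac-+ a d c d) (frac-≡ (a ℕ.* suc d ℕ.+ c ℕ.* suc d) (d ℕ.+ d ℕ.* suc d) (a ℕ.+ c) d (cancel a c (suc d)))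
    where
    cancel : ∀ a c s → (a ℕ.* s ℕ.+ c ℕ.* s) ℕ.* s ≡ (a ℕ.+ c) ℕ.* (s ℕ.* s)
    cancel = solve 3 (λ a c s → (a :* s :+ c :* s) :* s := (a :+ c) :* (s :* s)) refl

  frac-* : ∀ a b c d → frac a b * frac c d ≡ frac (a ℕ.* c) (b ℕ.* d)
  frac-* a zero c d = ℚP.*-zeroˡ (frac c d)
  frac-* a (suc b) c zero = trans (ℚP.*-zeroʳ (frac a (suc b))) (cong (frac (a ℕ.* c)) (sym (ℕP.*-zeroʳ (suc b))))
  frac-* a (suc b) c (suc d) = ℚP.toℚᵘ-injective (ℚᵘP.≃-trans (ℚP.toℚᵘ-homo-* (frac a (suc b)) (frac c (suc d)))
    (ℚᵘP.≃-trans (ℚᵘP.*-cong (toℚᵘ-frac a b) (toℚᵘ-frac c d)) (ℚᵘP.≃-trans (ℚᵘP.≃-reflexive numerator) (ℚᵘP.≃-sym (toℚᵘ-frac _ _)))))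
    where
    numerator : mkℚᵘ (+ a) b ℚᵘ.* mkℚᵘ (+ c) d ≡ mkℚᵘ (+ (a ℕ.* c)) (ℕ.pred (suc b ℕ.* suc d))
    numerator = cong (λ t → mkℚᵘ t (ℕ.pred (suc b ℕ.* suc d))) (sym (ℤP.pos-* a c))

  frac-1-inverse : ∀ L c → frac 1 (suc L) * (frac (suc L) 1 * c) ≡ c
  frac-1-inverse L c = trans (sym (ℚP.*-assoc (frac 1 (suc L)) _ c))
    (trans (cong (_* c) (trans (frac-* 1 (suc L) (suc L) 1) (frac-≡ (1 ℕ.* suc L) (L ℕ.* 1) 1 0 (solve 1 (λ l → con 1 :* (con 1 :+ l) :* con 1 := con 1 :* (con 1 :+ l :* con 1)) refl L)))) (ℚP.*-identityˡ c))


module Averages where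

  open import Level using (Level)
  open import Data.Nat as ℕ using (ℕ; suc; z≤n; s≤s)
  open import Data.Rational as ℚ using (ℚ; 0ℚ; 1ℚ; _+_; _*_; _≤_; _<_; _≤?_)
  import Data.Rational.Properties as ℚP
  open import Data.List using (List; []; _∷_; map; length)
  open import Data.List.Relation.Unary.All as All using (All; []; _∷_)
  open import Data.List.Relation.Unary.Any using (here; there)
  open import Data.List.Membership.Propositional using (_∈_)
  open import Data.Product using (Σ; _,_; _×_)
  open import Data.Sum using (_⊎_; inj₁; inj₂)
  open import Relation.Nullary using (yes; no; contradiction)
  open import Relation.Binary.PropositionalEquality
  open import Data.Rational.Solver using (module +-*-Solver)
  open +-*-Solver using (solve; _:+_; _:*_; con; _:=_)
  open import Defs
  open FiniteSums
  open Fractions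

  private
    variable
      a b : Level
      A : Set a
      B : Set b

  sumℚ-frac : ∀ (xs : List A) (g : A → ℕ) d → sumℚ (map (λ x → frac (g x) d) xs) ≡ frac (∑ xs g) d
  sumℚ-frac [] g d = sym (frac-0 d)
  sumℚ-frac (x ∷ xs) g d = trans (cong (frac (g x) d +_) (sumℚ-frac xs g d)) (frac-+-same (g x) (∑ xs g) d)

  *-sumℚ : ∀ (xs : List A) c (f : A → ℚ) → c * sumℚ (map f xs) ≡ sumℚ (map (λ x → c * f x) xs)
  *-sumℚ [] c f = ℚP.*-zeroʳ c
  *-sumℚ (x ∷ xs) c f = trans (ℚP.*-distribˡ-+ c (f x) _) (cong (c * f x +_) (*-sumℚ xs c f))

  sumℚ-cong : ∀ (xs : List A) {f g : A → ℚ} → (∀ x → f x ≡ g x) → sumℚ (map f xs) ≡ sumℚ (map g xs)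
  sumℚ-cong [] e = refl
  sumℚ-cong (x ∷ xs) e = cong₂ _+_ (e x) (sumℚ-cong xs e)

  sumℚ-congᴬ : ∀ {P : A → Set} (xs : List A) {f g : A → ℚ} → All P xs → (∀ x → P x → f x ≡ g x) → sumℚ (map f xs) ≡ sumℚ (map g xs)
  sumℚ-congᴬ [] _ e = refl
  sumℚ-congᴬ (x ∷ xs) (px ∷ pxs) e = cong₂ _+_ (e x px) (sumℚ-congᴬ xs pxs e)

  sumℚ-+ : ∀ (xs : List A) (f g : A → ℚ) → sumℚ (map (λ x → f x + g x) xs) ≡ sumℚ (map f xs) + sumℚ (map g xs)
  sumℚ-+ [] f g = refl
  sumℚ-+ (x ∷ xs) f g rewrite sumℚ-+ xs f g =
    solve 4 (λ a b c d → (a :+ b) :+ (c :+ d) := (a :+ c) :+ (b :+ d)) refl (f x) (g x) (sumℚ (map f xs)) (sumℚ (map g xs))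

  sumℚ-0 : ∀ (xs : List A) → sumℚ (map (λ _ → 0ℚ) xs) ≡ 0ℚ
  sumℚ-0 [] = refl
  sumℚ-0 (x ∷ xs) = trans (ℚP.+-identityˡ _) (sumℚ-0 xs)

  sumℚ-comm : ∀ (xs : List A) (ys : List B) (f : A → B → ℚ) →
    sumℚ (map (λ x → sumℚ (map (f x) ys)) xs) ≡ sumℚ (map (λ y → sumℚ (map (λ x → f x y) xs)) ys)
  sumℚ-comm [] ys f = sym (sumℚ-0 ys)
  sumℚ-comm (x ∷ xs) ys f rewrite sumℚ-comm xs ys f = sym (sumℚ-+ ys (f x) (λ y → sumℚ (map (λ x → f x y) xs)))

  sumℚ-mono : ∀ (xs : List A) {f g : A → ℚ} → All (λ x → f x ≤ g x) xs → sumℚ (map f xs) ≤ sumℚ (map g xs)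
  sumℚ-mono [] _ = ℚP.≤-refl
  sumℚ-mono (x ∷ xs) (p ∷ ps) = ℚP.+-mono-≤ p (sumℚ-mono xs ps)

  sumℚ-mono-< : ∀ (x : A) xs {f g : A → ℚ} → All (λ x → f x < g x) (x ∷ xs) → sumℚ (map f (x ∷ xs)) < sumℚ (map g (x ∷ xs))
  sumℚ-mono-< x xs (p ∷ ps) = ℚP.+-mono-<-≤ p (sumℚ-mono xs (All.map ℚP.<⇒≤ ps))

  sumℚ-const : ∀ (xs : List A) c → sumℚ (map (λ _ → c) xs) ≡ frac (length xs) 1 * c
  sumℚ-const [] c = sym (ℚP.*-zeroˡ c)
  sumℚ-const (x ∷ xs) c = begin
    c + sumℚ (map (λ _ → c) xs)         ≡⟨ cong (c +_) (sumℚ-const xs c) ⟩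
    c + frac (length xs) 1 * c          ≡⟨ solve 2 (λ c l → c :+ l :* c := (con 1ℚ :+ l) :* c) refl c (frac (length xs) 1) ⟩
    (1ℚ + frac (length xs) 1) * c       ≡⟨ cong (λ t → (t + frac (length xs) 1) * c) (sym (frac-≡ 1 0 1 0 refl)) ⟩
    (frac 1 1 + frac (length xs) 1) * c ≡⟨ cong (_* c) (frac-+-same 1 (length xs) 1) ⟩
    frac (suc (length xs)) 1 * c        ∎
    where open ≡-Reasoning

  average : List A → (A → ℚ) → ℚ
  average xs f = frac 1 (length xs) * sumℚ (map f xs)

  average-const : ∀ (x : A) xs c → average (x ∷ xs) (λ _ → c) ≡ c
  average-const x xs c = trans (cong (frac 1 (suc (length xs)) *_) (sumℚ-const (x ∷ xs) c)) (frac-1-inverse (length xs) c)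

  ≤-average : ∀ {x₀ : A} xs → x₀ ∈ xs → (f : A → ℚ) (c : ℚ) → All (λ x → c ≤ f x) xs → c ≤ average xs f
  ≤-average (x ∷ xs) _ f c c≤f = begin
    c                          ≡⟨ sym (average-const x xs c) ⟩
    average (x ∷ xs) (λ _ → c) ≤⟨ ℚP.*-monoˡ-≤-nonNeg (frac 1 (suc (length xs))) {{ℚ.nonNegative (0≤frac 1 (suc (length xs)))}} (sumℚ-mono (x ∷ xs) c≤f) ⟩
    average (x ∷ xs) f         ∎
    where open ℚP.≤-Reasoning

  find-≥ : ∀ (xs : List A) (f : A → ℚ) (c : ℚ) → Σ A (λ x → x ∈ xs × c ≤ f x) ⊎ All (λ x → f x < c) xs
  find-≥ [] f c = inj₂ []
  find-≥ (x ∷ xs) f c with c ≤? f x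
  ... | yes c≤fx = inj₁ (x , here refl , c≤fx)
  ... | no c≰fx with find-≥ xs f c
  ...   | inj₁ (y , y∈xs , c≤fy) = inj₁ (y , there y∈xs , c≤fy)
  ...   | inj₂ f<c = inj₂ (ℚP.≰⇒> c≰fx ∷ f<c)

  ≤-average⇒∃ : ∀ {x₀ : A} xs → x₀ ∈ xs → (f : A → ℚ) (c : ℚ) → c ≤ average xs f → Σ A (λ x → x ∈ xs × c ≤ f x)
  ≤-average⇒∃ (x ∷ xs) _ f c c≤avg with find-≥ (x ∷ xs) f c
  ... | inj₁ found = found
  ... | inj₂ f<c = contradiction (begin-strict
    c                          ≤⟨ c≤avg ⟩
    average (x ∷ xs) f         <⟨ ℚP.*-monoʳ-<-pos (frac 1 (suc (length xs))) {{1/L>0}} (sumℚ-mono-< x xs f<c) ⟩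
    average (x ∷ xs) (λ _ → c) ≡⟨ average-const x xs c ⟩
    c                               ∎) (ℚP.<-irrefl refl)
    where
    open ℚP.≤-Reasoning
    1/L>0 : ℚ.Positive (frac 1 (suc (length xs)))
    1/L>0 = ℚ.positive (subst (_< frac 1 (suc (length xs))) (frac-0 1) (frac-< 0 0 1 (length xs) (s≤s z≤n)))


module ExpectedDensity where

  open import Data.Nat as ℕ using (ℕ; _∸_)
  import Data.Nat.Properties as ℕP
  open import Data.Bool using (Bool)
  open import Data.Fin using (Fin)
  open import Data.Vec using (Vec)
  open import Data.Rational using (ℚ; _*_)
  open import Data.List using (map; length)
  open import Relation.Binary.PropositionalEquality
  open import Data.Rational.Solver using (module +-*-Solver)
  open +-*-Solver using (solve; _:*_; _:=_)
  open import Defs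
  open FiniteSums
  open Words
  open Restriction
  open DoubleCounting
  open Fractions
  open Averages

  module _ {k n : ℕ} (A : Vec (Fin k) n → Bool) where

    subspaceDensity : Subset n → ℚ
    subspaceDensity J = frac 1 (k ℕ.^ falses J) * sumℚ (map (sliceDensity A J) (cube k (falses J)))

    subspaceDensity≡average-cube : ∀ J → subspaceDensity J ≡ average (cube k (falses J)) (sliceDensity A J)
    subspaceDensity≡average-cube J = cong (λ L → frac 1 L * sumℚ (map (sliceDensity A J) (cube k (falses J)))) (sym (length-cube k (falses J)))

    -- Within a subspace the slice of type a has the same size for every y, so averaging over y adds up numerators.
    subspaceDensity≡average : ∀ J → subspaceDensity J ≡
      average (compositions k (trues J)) (λ a → frac (∑ (cube k (falses J)) (λ y → sliceHits A J y a)) (k ℕ.^ falses J ℕ.* sliceSize k (trues J) a))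
    subspaceDensity≡average J = begin
      frac 1 K * sumℚ (map (λ y → frac 1 L * sumℚ (map (λ a → frac (hits′ y a) (size a)) C)) Y)
        ≡⟨ cong (frac 1 K *_) (sym (*-sumℚ Y (frac 1 L) _)) ⟩
      frac 1 K * (frac 1 L * sumℚ (map (λ y → sumℚ (map (λ a → frac (hits′ y a) (size a)) C)) Y))
        ≡⟨ cong (λ s → frac 1 K * (frac 1 L * s)) (sumℚ-comm Y C _) ⟩
      frac 1 K * (frac 1 L * sumℚ (map (λ a → sumℚ (map (λ y → frac (hits′ y a) (size a)) Y)) C))
        ≡⟨ cong (λ s → frac 1 K * (frac 1 L * s)) (sumℚ-cong C (λ a → sumℚ-frac Y (λ y → hits′ y a) (size a))) ⟩
      frac 1 K * (frac 1 L * sumℚ (map (λ a → frac (∑ Y (λ y → hits′ y a)) (size a)) C))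
        ≡⟨ solve 3 (λ x y z → x :* (y :* z) := y :* (x :* z)) refl (frac 1 K) (frac 1 L) _ ⟩
      frac 1 L * (frac 1 K * sumℚ (map (λ a → frac (∑ Y (λ y → hits′ y a)) (size a)) C))
        ≡⟨ cong (frac 1 L *_) (*-sumℚ C (frac 1 K) _) ⟩
      frac 1 L * sumℚ (map (λ a → frac 1 K * frac (∑ Y (λ y → hits′ y a)) (size a)) C)
        ≡⟨ cong (frac 1 L *_) (sumℚ-cong C (λ a → trans (frac-* 1 K _ (size a)) (cong (λ w → frac w (K ℕ.* size a)) (ℕP.*-identityˡ _)))) ⟩
      frac 1 L * sumℚ (map (λ a → frac (∑ Y (λ y → hits′ y a)) (K ℕ.* size a)) C) ∎
      where
      open ≡-Reasoning
      K = k ℕ.^ falses J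
      C = compositions k (trues J)
      L = length C
      Y = cube k (falses J)
      hits′ = sliceHits A J
      size = sliceSize k (trues J)

    module _ (m : ℕ) where

      private
        S = subsetsOfSize n m
        C = compositions k m
        cellSize : Vec ℕ k → ℕ
        cellSize a = k ℕ.^ (n ∸ m) ℕ.* sliceSize k m a
        subspaceHits : Subset n → Vec ℕ k → ℕ
        subspaceHits J a = ∑ (cube k (falses J)) (λ y → sliceHits A J y a)

      falses≡n∸m : ∀ (J : Subset n) → trues J ≡ m → falses J ≡ n ∸ m
      falses≡n∸m J refl = trans (sym (ℕP.m+n∸m≡n (trues J) (falses J))) (cong (_∸ trues J) (trues+falses J))

      subspaceDensity≡average-of-size : ∀ J → trues J ≡ m →
        subspaceDensity J ≡ average C (λ a → frac (subspaceHits J a) (cellSize a))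
      subspaceDensity≡average-of-size J |J|≡m = trans (subspaceDensity≡average J) (reindex (trues J) (falses J) |J|≡m (falses≡n∸m J |J|≡m))
        where
        reindex : ∀ t f → t ≡ m → f ≡ n ∸ m →
          average (compositions k t) (λ a → frac (subspaceHits J a) (k ℕ.^ f ℕ.* sliceSize k t a)) ≡ average C (λ a → frac (subspaceHits J a) (cellSize a))
        reindex t f refl refl = refl

      total≡ : ∀ a → total k n m a ≡ length S ℕ.* cellSize a
      total≡ a = trans (total≡∑k^*sliceSize n m a)
        (trans (∑-congᴬ S (trues-subsetsOfSize n m) (λ J |J|≡m → cong₂ (λ f t → k ℕ.^ f ℕ.* sliceSize k t a) (falses≡n∸m J |J|≡m) |J|≡m))
               (∑-const S (cellSize a)))

      expectedSliceDensity≡average : expectedSliceDensity k n m A ≡ average C (λ a → frac (hits k n m A a) (total k n m a))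
      expectedSliceDensity≡average = begin
        frac 1 (length S) * sumℚ (map subspaceDensity S)
          ≡⟨ cong (frac 1 (length S) *_) (sumℚ-congᴬ S (trues-subsetsOfSize n m) (λ J → subspaceDensity≡average-of-size J)) ⟩
        frac 1 (length S) * sumℚ (map (λ J → frac 1 (length C) * sumℚ (map (λ a → frac (subspaceHits J a) (cellSize a)) C)) S)
          ≡⟨ cong (frac 1 (length S) *_) (sym (*-sumℚ S (frac 1 (length C)) _)) ⟩
        frac 1 (length S) * (frac 1 (length C) * sumℚ (map (λ J → sumℚ (map (λ a → frac (subspaceHits J a) (cellSize a)) C)) S))
          ≡⟨ cong (λ s → frac 1 (length S) * (frac 1 (length C) * s)) (sumℚ-comm S C _) ⟩
        frac 1 (length S) * (frac 1 (length C) * sumℚ (map (λ a → sumℚ (map (λ J → frac (subspaceHits J a) (cellSize a)) S)) C))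
          ≡⟨ cong (λ s → frac 1 (length S) * (frac 1 (length C) * s)) (sumℚ-cong C (λ a → sumℚ-frac S (λ J → subspaceHits J a) (cellSize a))) ⟩
        frac 1 (length S) * (frac 1 (length C) * sumℚ (map (λ a → frac (hits k n m A a) (cellSize a)) C))
          ≡⟨ solve 3 (λ x y z → x :* (y :* z) := y :* (x :* z)) refl (frac 1 (length S)) (frac 1 (length C)) _ ⟩
        frac 1 (length C) * (frac 1 (length S) * sumℚ (map (λ a → frac (hits k n m A a) (cellSize a)) C))
          ≡⟨ cong (frac 1 (length C) *_) (*-sumℚ C (frac 1 (length S)) _) ⟩
        frac 1 (length C) * sumℚ (map (λ a → frac 1 (length S) * frac (hits k n m A a) (cellSize a)) C)
          ≡⟨ cong (frac 1 (length C) *_) (sumℚ-cong C (λ a → trans (frac-* 1 (length S) _ (cellSize a)) (cong₂ frac (ℕP.*-identityˡ _) (sym (total≡ a))))) ⟩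
        average C (λ a → frac (hits k n m A a) (total k n m a)) ∎
        where open ≡-Reasoning


module Enumerations where

  open import Data.Nat as ℕ using (ℕ; zero; suc; z≤n; s≤s; _≤_)
  open import Data.Nat.Properties using (n<1+n; +-identityʳ; ≡ᵇ⇒≡)
  open import Data.Bool using (Bool; true; false; T)
  open import Data.Fin as Fin using (Fin)
  open import Data.Vec as Vec using (Vec; []; _∷_)
  open import Data.Vec.Relation.Unary.All as VecAll using ([]; _∷_)
  open import Data.List using (List; []; _∷_; map; filterᵇ; allFin; upTo)
  open import Data.List.Relation.Unary.Any as Any using (here; there)
  open import Data.List.Relation.Unary.All as All using (All)
  open import Data.List.Relation.Unary.All.Properties using (all-filter)
  open import Data.List.Membership.Propositional using (_∈_)
  open import Data.List.Membership.Propositional.Properties using (∈-map⁺; ∈-concatMap⁺; ∈-filter⁺; ∈-allFin; ∈-upTo⁺)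
  open import Data.Product using (Σ; _,_)
  open import Relation.Nullary.Decidable using (T?)
  open import Function using (_∘_)
  open import Relation.Binary.PropositionalEquality
  open import Defs
  open FiniteSums using (∑ᶠ)
  open Words

  ∈-allVecs : ∀ {A : Set} (xs : List A) {n} {v : Vec A n} → VecAll.All (_∈ xs) v → v ∈ allVecs xs n
  ∈-allVecs xs [] = here refl
  ∈-allVecs xs {v = x ∷ v} (x∈xs ∷ v⊆xs) =
    ∈-concatMap⁺ (λ w → map (_∷ w) xs) (Any.map (λ {w} v≡w → subst (λ w → x ∷ v ∈ map (_∷ w) xs) v≡w (∈-map⁺ (_∷ v) x∈xs)) (∈-allVecs xs v⊆xs))

  ∈-filterᵇ : ∀ {A : Set} (p : A → Bool) {xs : List A} {x} → x ∈ xs → p x ≡ true → x ∈ filterᵇ p xs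
  ∈-filterᵇ p x∈xs px = ∈-filter⁺ (T? ∘ p) x∈xs (subst T (sym px) _)

  ∈-cube : ∀ {k f} (v : Vec (Fin k) f) → v ∈ cube k f
  ∈-cube {k} v = ∈-allVecs (allFin k) (VecAll.universal ∈-allFin v)

  subsetOfSize : ∀ m n → m ≤ n → Σ (Subset n) (λ J → trues J ≡ m)
  subsetOfSize zero zero _ = [] , refl
  subsetOfSize zero (suc n) _ with subsetOfSize zero n z≤n
  ... | J , |J|≡0 = false ∷ J , |J|≡0
  subsetOfSize (suc m) (suc n) (s≤s m≤n) with subsetOfSize m n m≤n
  ... | J , |J|≡m = true ∷ J , cong suc |J|≡m

  ∈-subsetsOfSize : ∀ {n} (J : Subset n) → J ∈ subsetsOfSize n (trues J)
  ∈-subsetsOfSize J = ∈-filterᵇ (λ J′ → trues J′ ℕ.≡ᵇ trues J) (∈-allVecs _ (VecAll.universal bool∈ J)) (≡ᵇ-refl (trues J))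
    where
    bool∈ : ∀ b → b ∈ true ∷ false ∷ []
    bool∈ true = here refl
    bool∈ false = there (here refl)

  subsetsOfSize-nonempty : ∀ {m n} → m ≤ n → Σ (Subset n) (_∈ subsetsOfSize n m)
  subsetsOfSize-nonempty {m} {n} m≤n with subsetOfSize m n m≤n
  ... | J , refl = J , ∈-subsetsOfSize J

  ∑-compositions : ∀ k m → All (λ a → ∑ᶠ (Vec.lookup a) ≡ m) (compositions k m)
  ∑-compositions k m = All.map (λ {a} sum≡ᵇm → trans (sym (sum≡∑ᶠ a)) (≡ᵇ⇒≡ _ m sum≡ᵇm))
    (all-filter (T? ∘ (λ a → Vec.sum a ℕ.≡ᵇ m)) (allVecs (upTo (suc m)) k))

  ∈-compositions : ∀ k m → m ∷ Vec.replicate k 0 ∈ compositions (suc k) m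
  ∈-compositions k m = ∈-filterᵇ (λ a → Vec.sum a ℕ.≡ᵇ m)
    (∈-allVecs _ (∈-upTo⁺ (n<1+n m) ∷ zeros∈ k))
    (subst (λ t → (t ℕ.≡ᵇ m) ≡ true) (sym (trans (cong (m ℕ.+_) (sum-replicate-0 k)) (+-identityʳ m))) (≡ᵇ-refl m))
    where
    zeros∈ : ∀ k → VecAll.All (_∈ upTo (suc m)) (Vec.replicate k 0)
    zeros∈ zero = []
    zeros∈ (suc k) = ∈-upTo⁺ (s≤s z≤n) ∷ zeros∈ k
    sum-replicate-0 : ∀ k → Vec.sum (Vec.replicate k 0) ≡ 0
    sum-replicate-0 zero = refl
    sum-replicate-0 (suc k) = sum-replicate-0 k


module ChoiceOfN where

  open import Data.Nat as ℕ using (ℕ; zero; suc; _/_)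
  import Data.Nat.Properties as ℕP
  open import Data.Nat.DivMod using (m≡m%n+[m/n]*n; m%n<n; m/n*n≤m)
  open import Data.Integer as ℤ using (+_; +[1+_]; -[1+_])
  open import Data.Rational as ℚ using (ℚ; mkℚ; 0ℚ; 1ℚ; _*_; _≤_; _<_; _÷_; positive)
  import Data.Rational.Properties as ℚP
  open import Data.Rational.Properties using (pos⇒nonZero)
  open import Data.Product using (Σ; _,_; _×_)
  open import Relation.Binary.PropositionalEquality
  open import Data.Nat.Solver using (module +-*-Solver)
  open +-*-Solver using (solve; _:+_; _:*_; con; _:=_)
  open import Defs
  open Fractions

  positive-as-frac : ∀ η → 0ℚ < η → Σ ℕ λ p₀ → Σ ℕ λ q₀ → η ≡ frac (suc p₀) (suc q₀)
  positive-as-frac (mkℚ +[1+ p₀ ] q₀ c) _ = p₀ , q₀ , sym (ℚP.↥p/↧p≡p (mkℚ +[1+ p₀ ] q₀ c))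
  positive-as-frac (mkℚ (+ 0) q₀ c) η>0 with ℚP.drop-*<* η>0
  ... | ℤ.+<+ ()
  positive-as-frac (mkℚ -[1+ x ] q₀ c) η>0 with ℚP.drop-*<* η>0
  ... | ()

  powℚ-frac : ∀ x e → powℚ (frac x 1) e ≡ frac (x ℕ.^ e) 1
  powℚ-frac x zero = refl
  powℚ-frac x (suc e) = trans (cong (frac x 1 *_) (powℚ-frac x e)) (frac-* x 1 (x ℕ.^ e) 1)

  powℚ-nonneg : ∀ x e → 0ℚ ≤ x → 0ℚ ≤ powℚ x e
  powℚ-nonneg x zero _ = ℚP.<⇒≤ (ℚP.positive⁻¹ 1ℚ)
  powℚ-nonneg x (suc e) x≥0 = ℚP.nonNegative⁻¹ (x * powℚ x e)
    {{ℚP.nonNeg*nonNeg⇒nonNeg x {{ℚ.nonNegative x≥0}} (powℚ x e) {{ℚ.nonNegative (powℚ-nonneg x e x≥0)}}}}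

  powℚ-mono : ∀ x y e → 0ℚ ≤ x → x ≤ y → powℚ x e ≤ powℚ y e
  powℚ-mono x y zero _ _ = ℚP.≤-refl
  powℚ-mono x y (suc e) x≥0 x≤y = ℚP.≤-trans (ℚP.*-monoʳ-≤-nonNeg (powℚ x e) {{ℚ.nonNegative (powℚ-nonneg x e x≥0)}} x≤y)
    (ℚP.*-monoˡ-≤-nonNeg y {{ℚ.nonNegative (ℚP.≤-trans x≥0 x≤y)}} (powℚ-mono x y e x≥0 x≤y))

  powℚ≤⇒^≤ : ∀ e n G (X : ℚ) → frac G 1 ≤ X → powℚ X e ≤ (+ n) ℚ./ 1 → G ℕ.^ e ℕ.≤ n
  powℚ≤⇒^≤ e n G X G≤X Xᵉ≤n = ℕP.≤-trans (ℕP.≤-reflexive (sym (ℕP.*-identityʳ _)))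
    (ℕP.≤-trans (frac-≤⁻¹ (G ℕ.^ e) 0 n 0 (subst (_≤ frac n 1) (powℚ-frac G e) (ℚP.≤-trans (powℚ-mono (frac G 1) X e (0≤frac G 1) G≤X) Xᵉ≤n)))
      (ℕP.≤-reflexive (ℕP.*-identityʳ n)))

  q<[1+q/p]*p : ∀ p q .{{_ : ℕ.NonZero p}} → q ℕ.< suc (q / p) ℕ.* p
  q<[1+q/p]*p p q = ℕP.≤-trans (ℕP.≤-reflexive (cong suc (m≡m%n+[m/n]*n q p))) (ℕP.+-monoˡ-≤ (q / p ℕ.* p) (m%n<n q p))

  [1+q/p]*p≤2q : ∀ p q .{{_ : ℕ.NonZero p}} → p ℕ.≤ q → suc (q / p) ℕ.* p ℕ.≤ q ℕ.+ q
  [1+q/p]*p≤2q p q p≤q = ℕP.+-mono-≤ p≤q (m/n*n≤m q p)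

  1/N≤p/q : ∀ N₀ p₀ q₀ → suc q₀ ℕ.< suc N₀ ℕ.* suc p₀ → frac 1 (suc N₀) ≤ frac (suc p₀) (suc q₀)
  1/N≤p/q N₀ p₀ q₀ q<Np = frac-≤ 1 N₀ (suc p₀) q₀ (ℕP.≤-trans (ℕP.≤-reflexive (ℕP.+-identityʳ (suc q₀)))
    (ℕP.≤-trans (ℕP.<⇒≤ q<Np) (ℕP.≤-reflexive (ℕP.*-comm (suc N₀) (suc p₀)))))

  p/q≤1⇒p≤q : ∀ p₀ q₀ → frac (suc p₀) (suc q₀) ≤ 1ℚ → suc p₀ ℕ.≤ suc q₀
  p/q≤1⇒p≤q p₀ q₀ p/q≤1 = ℕP.≤-trans (ℕP.≤-reflexive (sym (ℕP.*-identityʳ (suc p₀))))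
    (ℕP.≤-trans (frac-≤⁻¹ (suc p₀) q₀ 1 0 p/q≤1) (ℕP.≤-reflexive (ℕP.+-identityʳ (suc q₀))))

  module _ (k : ℕ) (η : ℚ) (η>0 : 0ℚ < η) where

    16k/η : ℚ
    16k/η = (((+ (16 ℕ.* k)) ℚ./ 1) ÷ η) {{pos⇒nonZero η {{positive η>0}}}}

    16k/η*η : 16k/η * η ≡ frac (16 ℕ.* k) 1
    16k/η*η = trans (ℚP.*-assoc (frac (16 ℕ.* k) 1) _ η)
      (trans (cong (frac (16 ℕ.* k) 1 *_) (ℚP.*-inverseˡ η {{pos⇒nonZero η {{positive η>0}}}})) (ℚP.*-identityʳ _))

    8kN≤16k/η : ∀ N p₀ q₀ → η ≡ frac (suc p₀) (suc q₀) → N ℕ.* suc p₀ ℕ.≤ suc q₀ ℕ.+ suc q₀ → frac (8 ℕ.* k ℕ.* N) 1 ≤ 16k/η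
    8kN≤16k/η N p₀ q₀ η≡p/q Np≤2q = ℚP.*-cancelʳ-≤-pos η {{positive η>0}} (ℚP.≤-trans
      (subst (λ t → frac (8 ℕ.* k ℕ.* N) 1 * t ≤ frac (16 ℕ.* k) 1) (sym η≡p/q)
        (subst (_≤ frac (16 ℕ.* k) 1) (sym (frac-* (8 ℕ.* k ℕ.* N) 1 (suc p₀) (suc q₀)))
          (frac-≤ (8 ℕ.* k ℕ.* N ℕ.* suc p₀) (q₀ ℕ.+ 0) (16 ℕ.* k) 0 8kNp≤16kq)))
      (ℚP.≤-reflexive (sym 16k/η*η)))
      where
      8kNp≤16kq : 8 ℕ.* k ℕ.* N ℕ.* suc p₀ ℕ.* 1 ℕ.≤ 16 ℕ.* k ℕ.* suc (q₀ ℕ.+ 0)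
      8kNp≤16kq = ℕP.≤-trans (ℕP.≤-reflexive (solve 3 (λ k n p → con 8 :* k :* n :* p :* con 1 := con 8 :* k :* (n :* p)) refl k N (suc p₀)))
        (ℕP.≤-trans (ℕP.*-monoʳ-≤ (8 ℕ.* k) Np≤2q)
          (ℕP.≤-reflexive (solve 2 (λ k q → con 8 :* k :* (q :+ q) := con 16 :* k :* (q :+ con 0)) refl k (suc q₀))))

    -- With η = p/q the choice N = ⌊q/p⌋ + 1 gives q < N p, and N p ≤ 2q since p ≤ q.
    choose-N : ∀ n → η ≤ 1ℚ → powℚ 16k/η 12 ≤ (+ n) ℚ./ 1 → Σ ℕ λ N₀ → frac 1 (suc N₀) ≤ η × (8 ℕ.* k ℕ.* suc N₀) ℕ.^ 12 ℕ.≤ n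
    choose-N n η≤1 hyp with positive-as-frac η η>0
    ... | p₀ , q₀ , η≡p/q =
      suc q₀ / suc p₀ ,
      subst (frac 1 (suc (suc q₀ / suc p₀)) ≤_) (sym η≡p/q) (1/N≤p/q (suc q₀ / suc p₀) p₀ q₀ (q<[1+q/p]*p (suc p₀) (suc q₀))) ,
      powℚ≤⇒^≤ 12 n (8 ℕ.* k ℕ.* suc (suc q₀ / suc p₀)) 16k/η
        (8kN≤16k/η (suc (suc q₀ / suc p₀)) p₀ q₀ η≡p/q ([1+q/p]*p≤2q (suc p₀) (suc q₀) (p/q≤1⇒p≤q p₀ q₀ (subst (_≤ 1ℚ) η≡p/q η≤1)))) hyp


open import Defs
open import Data.Nat as ℕ using (ℕ; zero; suc)
import Data.Nat.Properties as ℕP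
open import Data.Fin as Fin using (Fin)
open import Data.Vec as Vec using (Vec)
open import Data.Bool using (Bool)
open import Data.Product using (Σ; _×_; _,_; proj₁; proj₂)
open import Data.Integer using (+_)
open import Data.Rational using (ℚ; 0ℚ; 1ℚ; _<_; _≤_; _+_; -_; _-_; _/_; _÷_; _≤?_; positive)
import Data.Rational.Properties as ℚP
open import Data.Rational.Properties using (pos⇒nonZero)
open import Data.List.Relation.Unary.All as All using (All)
open import Data.List.Properties using (length-filter)
open import Function using (_∘_)
open import Relation.Nullary using (yes; no)
open import Relation.Nullary.Decidable using (T?)
open import Relation.Binary.PropositionalEquality using (_≡_; refl; sym; trans; cong; subst)
open import Data.Nat.Solver using (module +-*-Solver)
open +-*-Solver using (solve; _:+_; _:*_; con; _:=_)
open FiniteSums using (∑ᶠ)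
open Words using (length-cube)
open DoubleCounting
open SliceBound
open Fractions
open Averages
open ExpectedDensity
open Enumerations
open ChoiceOfN

frac≤frac+1/N : ∀ A K W T N₀ → 1 ℕ.≤ K → 1 ℕ.≤ T → suc N₀ ℕ.* A ℕ.* T ℕ.≤ suc N₀ ℕ.* K ℕ.* W ℕ.+ K ℕ.* T → frac A K ≤ frac W T + frac 1 (suc N₀)
frac≤frac+1/N A (suc K₀) W (suc T₀) N₀ _ _ h = subst (frac A (suc K₀) ≤_) (sym (frac-+ W T₀ 1 N₀))
  (frac-≤ A K₀ (W ℕ.* suc N₀ ℕ.+ 1 ℕ.* suc T₀) (N₀ ℕ.+ T₀ ℕ.* suc N₀)
    (ℕP.≤-trans (ℕP.≤-reflexive (solve 4 (λ a t n k → a :* (t :* n) := n :* a :* t) refl A (suc T₀) (suc N₀) (suc K₀)))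
      (ℕP.≤-trans h (ℕP.≤-reflexive (solve 4 (λ w t n k → n :* k :* w :+ k :* t := (w :* n :+ con 1 :* t) :* k) refl W (suc T₀) (suc N₀) (suc K₀))))))

≤+⇒-≤ : ∀ {d F r η : ℚ} → d ≤ F + r → r ≤ η → d - η ≤ F
≤+⇒-≤ {d} {F} {r} {η} d≤F+r r≤η = ℚP.≤-trans (ℚP.+-monoʳ-≤ d (ℚP.neg-antimono-≤ r≤η))
  (ℚP.≤-trans (ℚP.+-monoˡ-≤ (- r) d≤F+r) (ℚP.≤-reflexive (trans (ℚP.+-assoc F r (- r)) (trans (cong (λ t → F + t) (ℚP.+-inverseʳ r)) (ℚP.+-identityʳ F)))))

frac≤1 : ∀ a K → 1 ℕ.≤ K → a ℕ.≤ K → frac a K ≤ 1ℚ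
frac≤1 a (suc K₀) _ a≤K = frac-≤ a K₀ 1 0 (ℕP.≤-trans (ℕP.≤-reflexive (ℕP.*-identityʳ a)) (ℕP.≤-trans a≤K (ℕP.≤-reflexive (sym (ℕP.+-identityʳ (suc K₀))))))

uniformDensity≤1 : ∀ k n (A : Vec (Fin k) n → Bool) → 1 ℕ.≤ k → uniformDensity k n A ≤ 1ℚ
uniformDensity≤1 k n A k≥1 = frac≤1 (countL A (cube k n)) (k ℕ.^ n) (ℕP.m^n>0 k {{ℕ.>-nonZero k≥1}} n)
  (ℕP.≤-trans (length-filter (T? ∘ A) (cube k n)) (ℕP.≤-reflexive (length-cube k n)))

module _ (k n m₀ : ℕ) (A : Vec (Fin k) n → Bool) (k≥1 : 1 ℕ.≤ k) (m⁴≤n : suc m₀ ℕ.^ 4 ℕ.≤ n) (η : ℚ) (η>0 : 0ℚ < η)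
         (hyp : powℚ (16k/η k η η>0) 12 ≤ (+ n) / 1) (a : Vec ℕ k) (∑a≡m : ∑ᶠ (Vec.lookup a) ≡ suc m₀) where

  private
    m = suc m₀
    ratio = frac (hits k n m A a) (total k n m a)

  uniformDensity≤ratio+1/N : ∀ N₀ → (8 ℕ.* k ℕ.* suc N₀) ℕ.^ 12 ℕ.≤ n → uniformDensity k n A ≤ ratio + frac 1 (suc N₀)
  uniformDensity≤ratio+1/N N₀ G¹²≤n = frac≤frac+1/N (countL A (cube k n)) (k ℕ.^ n) (hits k n m A a) (total k n m a) N₀ (ℕP.m^n>0 k {{ℕ.>-nonZero k≥1}} n)
    (total≥1 N₀ k m₀ n A a ∑a≡m k≥1 m⁴≤n G¹²≤n) (N*#A*total≤ N₀ k m₀ n A a ∑a≡m k≥1 m⁴≤n G¹²≤n)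

  η≤1⇒uniformDensity-η≤ratio : η ≤ 1ℚ → uniformDensity k n A - η ≤ ratio
  η≤1⇒uniformDensity-η≤ratio η≤1 = ≤+⇒-≤ (uniformDensity≤ratio+1/N (proj₁ N) (proj₂ (proj₂ N))) (proj₁ (proj₂ N))
    where N = choose-N k η η>0 n η≤1 hyp

  uniformDensity-η≤ratio : uniformDensity k n A - η ≤ ratio
  uniformDensity-η≤ratio with uniformDensity k n A ≤? η
  ... | yes δ≤η = ℚP.≤-trans (ℚP.+-monoˡ-≤ (- η) δ≤η) (ℚP.≤-trans (ℚP.≤-reflexive (ℚP.+-inverseʳ η)) (0≤frac (hits k n m A a) (total k n m a)))
  ... | no δ≰η = η≤1⇒uniformDensity-η≤ratio (ℚP.<⇒≤ (ℚP.<-≤-trans (ℚP.≰⇒> δ≰η) (uniformDensity≤1 k n A k≥1)))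

corollary6p4 : (k n m : ℕ) → 1 ℕ.≤ k → 1 ℕ.≤ n → 1 ℕ.≤ m →
    (A : Vec (Fin k) n → Bool) (δ : ℚ) → δ ≡ uniformDensity k n A →
    (η : ℚ) (η>0 : 0ℚ < η) →
    m ℕ.^ 4 ℕ.≤ n →
    powℚ ((((+ (16 ℕ.* k)) / 1) ÷ η) {{pos⇒nonZero η {{positive η>0}}}}) 12 ≤ (+ n) / 1 →
    (δ - η ≤ expectedSliceDensity k n m A)
    × Σ (Subset n) (λ J → trues J ≡ m × Σ (Vec (Fin k) (falses J)) (λ y → δ - η ≤ sliceDensity A J y))
corollary6p4 (suc k₀) n (suc m₀) k≥1 _ _ A δ refl η η>0 m⁴≤n hyp = expected , J , |J|≡m , y , y-good
  where
  k = suc k₀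
  m = suc m₀
  expected : δ - η ≤ expectedSliceDensity k n m A
  expected = subst (δ - η ≤_) (sym (expectedSliceDensity≡average A m))
    (≤-average (compositions k m) (∈-compositions k₀ m) _ (δ - η) (All.map (λ {a} → uniformDensity-η≤ratio k n m₀ A k≥1 m⁴≤n η η>0 hyp a) (∑-compositions k m)))
  J₀∈ = subsetsOfSize-nonempty (ℕP.≤-trans (ℕP.m≤m*n m (m ℕ.^ 3)) m⁴≤n)
  found-J = ≤-average⇒∃ (subsetsOfSize n m) (proj₂ J₀∈) (subspaceDensity A) (δ - η) expected
  J = proj₁ found-J
  |J|≡m = All.lookup (trues-subsetsOfSize n m) (proj₁ (proj₂ found-J))
  found-y = ≤-average⇒∃ (cube k (falses J)) (∈-cube (Vec.replicate (falses J) Fin.zero)) (sliceDensity A J) (δ - η) (subst (δ - η ≤_) (subspaceDensity≡average-cube A J) (proj₂ (proj₂ found-J)))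
  y = proj₁ found-y
  y-good = proj₂ (proj₂ found-y)
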